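{- $\operatorname{cr}_2(9)=\operatorname{cr}_3(9)=5$.
   Context: A lattice simplex in $\mathbb{R}^d$ is the convex hull of $d+1$ affinely independent points of $\mathbb{Z}^d$; it is empty if its only lattice points are its vertices. After translating a vertex to the origin, write $\Delta=AS_d$ with $S_d=\operatorname{conv}\{\mathbf{0},e_1,\ldots,e_d\}$ and $A$ invertible integer; $G_\Delta=\mathbb{Z}^d/A\mathbb{Z}^d$, and $\operatorname{cr}(\Delta)$ is the number of elementary divisors of $A$ larger than $1$. For a prime $p$, a $p$-power simplex is a lattice simplex with $G_\Delta\cong(\mathbb{Z}_p)^s$ for some $s\ge0$, and $\operatorname{cr}_p(d)$ is the maximum of $\operatorname{cr}(\Delta)$ over all empty $p$-power simplices $\Delta\subseteq\mathbb{R}^d$. -}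

module Defs where

open import Data.Nat as ℕ using (ℕ; zero; suc; _≤_; _<?_)
import Data.Nat.Divisibility as ℕD
open import Data.Fin using (Fin; toℕ) renaming (zero to fzero; suc to fsuc)
open import Data.Integer as ℤ using (ℤ; +_)
open import Data.Integer.Divisibility as ℤD using ()
open import Data.Rational as ℚ using (ℚ; 0ℚ; 1ℚ)
open import Data.Product using (Σ; ∃; _×_; _,_)
open import Data.Sum using (_⊎_)
open import Relation.Nullary.Decidable using (⌊_⌋)
open import Relation.Binary.PropositionalEquality using (_≡_)
open import Data.Bool using (Bool; if_then_else_)

Mat : Set → ℕ → ℕ → Set
Mat R m n = Fin m → Fin n → R

Vecℤ : ℕ → Set
Vecℤ n = Fin n → ℤ

Vecℚ : ℕ → Set
Vecℚ n = Fin n → ℚ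

sumℤ : ∀ {n} → (Fin n → ℤ) → ℤ
sumℤ {zero}  f = + 0
sumℤ {suc n} f = f fzero ℤ.+ sumℤ (λ i → f (fsuc i))

sumℚ : ∀ {n} → (Fin n → ℚ) → ℚ
sumℚ {zero}  f = 0ℚ
sumℚ {suc n} f = f fzero ℚ.+ sumℚ (λ i → f (fsuc i))

count : ∀ {n} → (Fin n → Bool) → ℕ
count {zero}  f = 0
count {suc n} f = (if f fzero then 1 else 0) ℕ.+ count (λ i → f (fsuc i))

toℚ : ℤ → ℚ
toℚ z = z ℚ./ 1

_⊗_ : ∀ {m k n} → Mat ℤ m k → Mat ℤ k n → Mat ℤ m n
(A ⊗ B) i j = sumℤ (λ l → A i l ℤ.* B l j)

_·ℤ_ : ∀ {m n} → Mat ℤ m n → Vecℤ n → Vecℤ m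
(A ·ℤ x) i = sumℤ (λ j → A i j ℤ.* x j)

_·ℚ_ : ∀ {m n} → Mat ℤ m n → Vecℚ n → Vecℚ m
(A ·ℚ x) i = sumℚ (λ j → toℚ (A i j) ℚ.* x j)

δ : ∀ {n} → Fin n → Fin n → Bool
δ i j = ⌊ toℕ i ℕ.≟ toℕ j ⌋

idℤ : ∀ {n} → Mat ℤ n n
idℤ i j = if δ i j then + 1 else + 0

idℚ : ∀ {n} → Mat ℚ n n
idℚ i j = if δ i j then 1ℚ else 0ℚ

-- Equivalently the columns of A (the non-origin vertices of Δ = A S_n)
-- are linearly independent, i.e. the vertices of Δ are affinely independent.
Invertible : ∀ {n} → Mat ℤ n n → Set
Invertible {n} A = Σ (Mat ℚ n n) λ B →
  (∀ i j → sumℚ (λ l → toℚ (A i l) ℚ.* B l j) ≡ idℚ i j) ×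
  (∀ i j → sumℚ (λ l → B i l ℚ.* toℚ (A l j)) ≡ idℚ i j)

Unimodular : ∀ {n} → Mat ℤ n n → Set
Unimodular {n} U = Σ (Mat ℤ n n) λ U' →
  (∀ i j → (U ⊗ U') i j ≡ idℤ i j) × (∀ i j → (U' ⊗ U) i j ≡ idℤ i j)

-- The simplex Δ = A S_n, S_n = conv{0, e_1, ..., e_n}, is empty:
-- every lattice point of Δ is a vertex.  A point of Δ is A λ with λ in S_n;
-- if A λ is a lattice point then λ = A⁻¹(Aλ) is rational, so it suffices to
-- quantify over rational barycentric coordinates λ.  The vertices are A·0
-- and A e_j, i.e. λ = 0 or λ = e_j (A is injective).
Empty : ∀ {n} → Mat ℤ n n → Set
Empty {n} A = (λv : Vecℚ n) →
  (∀ i → 0ℚ ℚ.≤ λv i) → sumℚ λv ℚ.≤ 1ℚ →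
  (Σ (Vecℤ n) λ x → ∀ i → (A ·ℚ λv) i ≡ toℚ (x i)) →
  (∀ i → λv i ≡ 0ℚ) ⊎ (Σ (Fin n) λ j → ∀ i → λv i ≡ idℚ i j)

-- G_Δ = ℤⁿ / Aℤⁿ is isomorphic to (ℤ_p)^s: there is a group homomorphism
-- ℤⁿ → (ℤ/pℤ)^s, given by an integer s×n matrix M reduced mod p, which is
-- surjective and whose kernel is exactly Aℤⁿ (first isomorphism theorem).
GroupIsElemAbelian : ∀ {n} → ℕ → Mat ℤ n n → ℕ → Set
GroupIsElemAbelian {n} p A s = Σ (Mat ℤ s n) λ M →
  ((x : Vecℤ n) →
     ((∀ i → (+ p) ℤD.∣ (M ·ℤ x) i) → Σ (Vecℤ n) λ y → ∀ i → (A ·ℤ y) i ≡ x i) ×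
     ((Σ (Vecℤ n) λ y → ∀ i → (A ·ℤ y) i ≡ x i) → ∀ i → (+ p) ℤD.∣ (M ·ℤ x) i)) ×
  ((t : Vecℤ s) → Σ (Vecℤ n) λ x → ∀ i → (+ p) ℤD.∣ ((M ·ℤ x) i ℤ.- t i))

PPower : ∀ {n} → ℕ → Mat ℤ n n → Set
PPower p A = ∃ λ s → GroupIsElemAbelian p A s

ElemDivs : ∀ {n} → Mat ℤ n n → (Fin n → ℕ) → Set
ElemDivs {n} A d = Σ (Mat ℤ n n) λ U → Σ (Mat ℤ n n) λ V →
  Unimodular U × Unimodular V ×
  (∀ i j → ((U ⊗ A) ⊗ V) i j ≡ (if δ i j then + d i else + 0)) ×
  (∀ i → 1 ≤ d i) ×
  (∀ i j → toℕ i ≤ toℕ j → d i ℕD.∣ d j)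

Cr : ∀ {n} → Mat ℤ n n → ℕ → Set
Cr A k = Σ _ λ d → ElemDivs A d × count (λ i → ⌊ 1 <? d i ⌋) ≡ k

CrP≡ : ℕ → ℕ → ℕ → Set
CrP≡ p n k =
  (Σ (Mat ℤ n n) λ A → Invertible A × Empty A × PPower p A × Cr A k) ×
  ((A : Mat ℤ n n) (k' : ℕ) → Invertible A → Empty A → PPower p A → Cr A k' → k' ℕ.≤ k)

-- Write U A V = diag d in Smith normal form.  As G_Δ is elementary abelian,
-- every elementary divisor divides p, so if cr(Δ) > s the rows of U A below the first
-- m = n - s - 1 vanish modulo p.  Weights c ∈ ℕⁿ with Σ c ≤ p and A c ≡ 0 (mod p) give the
-- lattice point A c / p of Δ with barycentric coordinates c / p, so in an empty Δ they are
-- 0 or p·eⱼ.  Hence cr(Δ) ≤ s as soon as every m × n integer matrix R admits such weights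
-- with an entry strictly between 0 and p.  Adjoin the origin to the columns of R and reduce
-- modulo p: ten points of 𝔽₂³ contain two equal ones (weights eⱼ + eₖ), and ten points of
-- 𝔽₃³ contain two equal ones (eⱼ + 2eₖ) or three on a line (eⱼ + eₖ + eₗ), because caps in
-- 𝔽₃³ have at most 9 points (an exhaustive search).
--
-- A = [[I₄, N], [0, p·I₅]] has G_Δ ≅ ℤ_p⁵.  Since p·A⁻¹ is integral, every
-- lattice point of Δ has barycentric coordinates in (1/p)ℤ, so emptiness is the same
-- condition on weights, which is checked by enumeration for suitable N.

module Submission where

open import Defs
open import Data.Product using (_×_; Σ; ∃; _,_; proj₁; proj₂)
open import Data.Nat as ℕ using (ℕ; zero; suc; _<_; _≤_; z≤n; s≤s; _%_; _/_; _≡ᵇ_; _≤ᵇ_; _<ᵇ_)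
import Data.Nat.Properties as ℕP
import Data.Nat.Divisibility as ℕD
open import Data.Nat.DivMod using (m%n<n)
open import Data.Nat.Primality using (Prime; prime⇒irreducible; prime[2]; prime?)
open import Data.Fin as Fin using (Fin; toℕ; _≟_; _↑ˡ_; _↑ʳ_; splitAt) renaming (zero to fzero; suc to fsuc)
import Data.Fin.Properties as FinP
open import Data.Fin.Patterns using (0F; 1F; 2F)
open import Data.Integer as ℤ using (ℤ; +_; _+_; _*_; _-_)
import Data.Integer.Properties as ℤP
open import Data.Integer.DivMod using (_%ℕ_; _/ℕ_; n%ℕd<d; a≡a%ℕn+[a/ℕn]*n)
open import Data.Integer.Divisibility.Signed as ℤS using (_∣_)
import Data.Integer.Divisibility as ℤD
open import Data.Integer.Tactic.RingSolver using (solve-∀)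
open import Data.Rational as ℚ using (ℚ; 0ℚ; 1ℚ)
import Data.Rational.Properties as ℚP
open import Data.Rational.Unnormalised as ℚᵘ using (mkℚᵘ; *≡*; *≤*)
import Data.Rational.Unnormalised.Properties as ℚᵘP
open import Data.Bool using (Bool; true; false; if_then_else_; _∧_; _∨_; not; T)
import Data.Bool.Properties as BoolP
open import Data.Bool.ListAction using (any)
open import Data.Sum using (_⊎_; inj₁; inj₂; [_,_]′)
open import Data.Empty using (⊥; ⊥-elim)
open import Data.List using (List; []; _∷_; length; filter; replicate; map; _++_; allFin)
import Data.List.Properties as ListP
open import Data.List.Relation.Unary.All as All using (All; []; _∷_)
import Data.List.Relation.Unary.All.Properties as AllP
open import Data.List.Relation.Unary.AllPairs as AllPairs using (AllPairs; []; _∷_)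
open import Data.List.Relation.Unary.Any as Any using (here; there)
open import Data.List.Relation.Unary.Linked.Properties using (Linked⇒AllPairs)
open import Data.List.Relation.Unary.Unique.Propositional using (Unique)
import Data.List.Relation.Unary.Unique.Propositional.Properties as Unique
open import Data.List.Membership.Propositional using (_∈_)
open import Data.List.Membership.Propositional.Properties using (∈-map⁺; ∈-map⁻; ∈-allFin)
open import Data.List.Relation.Binary.Permutation.Propositional using (↭-sym; ↭⇒↭ₛ)
open import Data.List.Relation.Binary.Permutation.Propositional.Properties using (↭-length; ∈-resp-↭)
import Data.List.Relation.Binary.Permutation.Setoid.Properties as PermutationSetoid
open import Data.List.Sort ℕP.≤-decTotalOrder using (sort; sort-↗; sort-↭)
open import Data.Vec as Vec using (Vec; []; _∷_; lookup; tabulate)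
import Data.Vec.Properties as VecP
open import Relation.Nullary using (¬_; Dec; does; yes; no)
open import Relation.Nullary.Decidable
  using (⌊_⌋; dec-true; dec-false; isYes≗does; from-yes; map′; ¬?; _×-dec_; _→-dec_; _⊎-dec_)
open import Relation.Unary using (Decidable)
open import Relation.Binary.PropositionalEquality
open import Function using (_∘_)
open import Algebra.Bundles using (CommutativeMonoid)
import Algebra.Properties.CommutativeSemigroup as CommSemigroupProperties

module ℤ+ = CommSemigroupProperties ℤP.+-commutativeSemigroup
module ℚ+ = CommSemigroupProperties (CommutativeMonoid.commutativeSemigroup ℚP.+-0-commutativeMonoid)

-- Finite sums and integer matrices

+ᵛ_ : ∀ {n} → (Fin n → ℕ) → Vecℤ n
(+ᵛ c) j = + c j

δ≡does-≟ : ∀ {n} (i j : Fin n) → δ i j ≡ does (i ≟ j)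
δ≡does-≟ i j with i ≟ j
... | yes refl = trans (isYes≗does (toℕ i ℕP.≟ toℕ i)) (dec-true (toℕ i ℕP.≟ toℕ i) refl)
... | no i≢j   = trans (isYes≗does (toℕ i ℕP.≟ toℕ j))
                       (dec-false (toℕ i ℕP.≟ toℕ j) (i≢j ∘ FinP.toℕ-injective))

sumℤ-cong : ∀ {n} {f g : Fin n → ℤ} → (∀ i → f i ≡ g i) → sumℤ f ≡ sumℤ g
sumℤ-cong {zero}  f≗g = refl
sumℤ-cong {suc n} f≗g = cong₂ _+_ (f≗g fzero) (sumℤ-cong (f≗g ∘ fsuc))

sumℤ-zero : ∀ n → sumℤ {n} (λ _ → + 0) ≡ + 0
sumℤ-zero zero    = refl
sumℤ-zero (suc n) = cong (_+_ (+ 0)) (sumℤ-zero n)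

sumℤ-distrib-+ : ∀ {n} (f g : Fin n → ℤ) → sumℤ (λ i → f i + g i) ≡ sumℤ f + sumℤ g
sumℤ-distrib-+ {zero}  f g = refl
sumℤ-distrib-+ {suc n} f g =
  trans (cong (_+_ (f fzero + g fzero)) (sumℤ-distrib-+ (f ∘ fsuc) (g ∘ fsuc)))
        (ℤ+.interchange (f fzero) (g fzero) _ _)

*-distribˡ-sumℤ : ∀ {n} (a : ℤ) (f : Fin n → ℤ) → a * sumℤ f ≡ sumℤ (λ i → a * f i)
*-distribˡ-sumℤ {zero}  a f = ℤP.*-zeroʳ a
*-distribˡ-sumℤ {suc n} a f =
  trans (ℤP.*-distribˡ-+ a (f fzero) _) (cong (_+_ (a * f fzero)) (*-distribˡ-sumℤ a (f ∘ fsuc)))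

sumℤ-comm : ∀ {m n} (f : Fin m → Fin n → ℤ) →
            sumℤ (λ i → sumℤ (f i)) ≡ sumℤ (λ j → sumℤ (λ i → f i j))
sumℤ-comm {zero}  {n} f = sym (sumℤ-zero n)
sumℤ-comm {suc m} {n} f =
  trans (cong (_+_ (sumℤ (f fzero))) (sumℤ-comm (f ∘ fsuc)))
        (sym (sumℤ-distrib-+ (f fzero) _))

sumℤ-select : ∀ {n} (i : Fin n) (f : Fin n → ℤ) →
              sumℤ (λ j → if does (i ≟ j) then f j else + 0) ≡ f i
sumℤ-select {suc n} fzero    f = trans (cong (_+_ (f fzero)) (sumℤ-zero n)) (ℤP.+-identityʳ _)
sumℤ-select {suc n} (fsuc i) f = trans (ℤP.+-identityˡ _) (sumℤ-select i (f ∘ fsuc))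

∣-sumℤ : ∀ {n} {k : ℤ} (f : Fin n → ℤ) → (∀ j → k ∣ f j) → k ∣ sumℤ f
∣-sumℤ {zero}  f k∣f = ℤS.divides (+ 0) refl
∣-sumℤ {suc n} f k∣f = ℤS.∣m∣n⇒∣m+n (k∣f fzero) (∣-sumℤ (f ∘ fsuc) (k∣f ∘ fsuc))

·ℤ-congˡ : ∀ {m n} (X : Mat ℤ m n) {v w : Vecℤ n} → (∀ j → v j ≡ w j) →
           ∀ i → (X ·ℤ v) i ≡ (X ·ℤ w) i
·ℤ-congˡ X v≗w i = sumℤ-cong (λ j → cong (X i j *_) (v≗w j))

·ℤ-congʳ : ∀ {m n} {X Y : Mat ℤ m n} → (∀ i j → X i j ≡ Y i j) → (w : Vecℤ n) →
           ∀ i → (X ·ℤ w) i ≡ (Y ·ℤ w) i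
·ℤ-congʳ X≗Y w i = sumℤ-cong (λ j → cong (_* w j) (X≗Y i j))

·ℤ-scale : ∀ {m n} (X : Mat ℤ m n) (a : ℤ) (w : Vecℤ n) i → (X ·ℤ (λ j → a * w j)) i ≡ a * (X ·ℤ w) i
·ℤ-scale X a w i =
  trans (sumℤ-cong (λ j → swap (X i j) a (w j))) (sym (*-distribˡ-sumℤ a (λ j → X i j * w j)))
  where swap : ∀ x a w → x * (a * w) ≡ a * (x * w)
        swap = solve-∀

·ℤ-assoc : ∀ {m k n} (X : Mat ℤ m k) (Y : Mat ℤ k n) (w : Vecℤ n) i →
           ((X ⊗ Y) ·ℤ w) i ≡ (X ·ℤ (Y ·ℤ w)) i
·ℤ-assoc X Y w i = begin
  sumℤ (λ j → sumℤ (λ l → X i l * Y l j) * w j)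
    ≡⟨ sumℤ-cong (λ j → trans (ℤP.*-comm _ (w j)) (*-distribˡ-sumℤ (w j) (λ l → X i l * Y l j))) ⟩
  sumℤ (λ j → sumℤ (λ l → w j * (X i l * Y l j)))
    ≡⟨ sumℤ-comm (λ j l → w j * (X i l * Y l j)) ⟩
  sumℤ (λ l → sumℤ (λ j → w j * (X i l * Y l j)))
    ≡⟨ sumℤ-cong (λ l → sumℤ-cong (λ j → rearrange (w j) (X i l) (Y l j))) ⟩
  sumℤ (λ l → sumℤ (λ j → X i l * (Y l j * w j)))
    ≡⟨ sumℤ-cong (λ l → sym (*-distribˡ-sumℤ (X i l) (λ j → Y l j * w j))) ⟩
  sumℤ (λ l → X i l * sumℤ (λ j → Y l j * w j)) ∎
  where open ≡-Reasoning
        rearrange : ∀ a b c → a * (b * c) ≡ b * (c * a)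
        rearrange = solve-∀

·ℤ-diagonal : ∀ {n} (a : ℤ) (w : Vecℤ n) i → sumℤ (λ j → (if δ i j then a else + 0) * w j) ≡ a * w i
·ℤ-diagonal a w i =
  trans (sumℤ-cong (λ j → trans (cong (λ b → (if b then a else + 0) * w j) (δ≡does-≟ i j))
                                (if-* (does (i ≟ j)) (w j))))
        (sumℤ-select i (λ j → a * w j))
  where if-* : ∀ b x → (if b then a else + 0) * x ≡ (if b then a * x else + 0)
        if-* true  x = refl
        if-* false x = refl

·ℤ-identityˡ : ∀ {n} (w : Vecℤ n) i → (idℤ ·ℤ w) i ≡ w i
·ℤ-identityˡ w i = trans (·ℤ-diagonal (+ 1) w i) (ℤP.*-identityˡ (w i))

⊗-identityˡ : ∀ {m n} (X : Mat ℤ m n) i j → (idℤ ⊗ X) i j ≡ X i j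
⊗-identityˡ X i j = ·ℤ-identityˡ (λ l → X l j) i

·ℤ-scaledInverse : ∀ {n} (a : ℤ) (X Y : Mat ℤ n n) → (∀ i j → (X ⊗ Y) i j ≡ a * idℤ i j) →
                   (w : Vecℤ n) → ∀ i → (X ·ℤ (Y ·ℤ w)) i ≡ a * w i
·ℤ-scaledInverse a X Y XY≡aI w i = begin
  (X ·ℤ (Y ·ℤ w)) i                ≡⟨ sym (·ℤ-assoc X Y w i) ⟩
  ((X ⊗ Y) ·ℤ w) i                 ≡⟨ ·ℤ-congʳ XY≡aI w i ⟩
  sumℤ (λ j → a * idℤ i j * w j)   ≡⟨ sumℤ-cong (λ j → ℤP.*-assoc a (idℤ i j) (w j)) ⟩
  sumℤ (λ j → a * (idℤ i j * w j)) ≡⟨ sym (*-distribˡ-sumℤ a (λ j → idℤ i j * w j)) ⟩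
  a * (idℤ ·ℤ w) i                 ≡⟨ cong (a *_) (·ℤ-identityˡ w i) ⟩
  a * w i                          ∎
  where open ≡-Reasoning

·ℤ-inverse : ∀ {n} (X Y : Mat ℤ n n) → (∀ i j → (X ⊗ Y) i j ≡ idℤ i j) →
             (w : Vecℤ n) → ∀ i → (X ·ℤ (Y ·ℤ w)) i ≡ w i
·ℤ-inverse X Y XY≡I w i =
  trans (·ℤ-scaledInverse (+ 1) X Y (λ i j → trans (XY≡I i j) (sym (ℤP.*-identityˡ _))) w i)
        (ℤP.*-identityˡ (w i))

toℚᵘ-toℚ : ∀ z → ℚ.toℚᵘ (toℚ z) ℚᵘ.≃ mkℚᵘ z 0
toℚᵘ-toℚ z = ℚP.toℚᵘ-fromℚᵘ (mkℚᵘ z 0)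

toℚ-+ : ∀ a b → toℚ (a + b) ≡ toℚ a ℚ.+ toℚ b
toℚ-+ a b = ℚP.toℚᵘ-injective (begin
  ℚ.toℚᵘ (toℚ (a + b))                ≈⟨ toℚᵘ-toℚ (a + b) ⟩
  mkℚᵘ (a + b) 0                      ≈⟨ *≡* (solve a b) ⟩
  mkℚᵘ a 0 ℚᵘ.+ mkℚᵘ b 0              ≈⟨ ℚᵘP.+-cong (toℚᵘ-toℚ a) (toℚᵘ-toℚ b) ⟨
  ℚ.toℚᵘ (toℚ a) ℚᵘ.+ ℚ.toℚᵘ (toℚ b)  ≈⟨ ℚP.toℚᵘ-homo-+ (toℚ a) (toℚ b) ⟨
  ℚ.toℚᵘ (toℚ a ℚ.+ toℚ b)            ∎)
  where open ℚᵘP.≃-Reasoning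
        solve : ∀ a b → (a + b) * + 1 ≡ (a * + 1 + b * + 1) * + 1
        solve = solve-∀

toℚ-* : ∀ a b → toℚ (a * b) ≡ toℚ a ℚ.* toℚ b
toℚ-* a b = ℚP.toℚᵘ-injective (begin
  ℚ.toℚᵘ (toℚ (a * b))                ≈⟨ toℚᵘ-toℚ (a * b) ⟩
  mkℚᵘ a 0 ℚᵘ.* mkℚᵘ b 0              ≈⟨ ℚᵘP.*-cong (toℚᵘ-toℚ a) (toℚᵘ-toℚ b) ⟨
  ℚ.toℚᵘ (toℚ a) ℚᵘ.* ℚ.toℚᵘ (toℚ b)  ≈⟨ ℚP.toℚᵘ-homo-* (toℚ a) (toℚ b) ⟨
  ℚ.toℚᵘ (toℚ a ℚ.* toℚ b)            ∎)
  where open ℚᵘP.≃-Reasoning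

toℚ-injective : ∀ {a b} → toℚ a ≡ toℚ b → a ≡ b
toℚ-injective {a} {b} eq
  with *≡* a*1≡b*1 ← ℚᵘP.≃-trans (ℚᵘP.≃-sym (toℚᵘ-toℚ a))
                                  (ℚᵘP.≃-trans (ℚP.toℚᵘ-cong eq) (toℚᵘ-toℚ b))
  = trans (sym (ℤP.*-identityʳ a)) (trans a*1≡b*1 (ℤP.*-identityʳ b))

toℚ-mono-≤ : ∀ {a b} → a ℤ.≤ b → toℚ a ℚ.≤ toℚ b
toℚ-mono-≤ {a} {b} a≤b = ℚP.toℚᵘ-cancel-≤
  (ℚᵘP.≤-respʳ-≃ (ℚᵘP.≃-sym (toℚᵘ-toℚ b)) (ℚᵘP.≤-respˡ-≃ (ℚᵘP.≃-sym (toℚᵘ-toℚ a))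
    (*≤* (subst₂ ℤ._≤_ (sym (ℤP.*-identityʳ a)) (sym (ℤP.*-identityʳ b)) a≤b))))

toℚ-cancel-≤ : ∀ {a b} → toℚ a ℚ.≤ toℚ b → a ℤ.≤ b
toℚ-cancel-≤ {a} {b} a≤b
  with *≤* a*1≤b*1 ← ℚᵘP.≤-respʳ-≃ (toℚᵘ-toℚ b)
                                    (ℚᵘP.≤-respˡ-≃ (toℚᵘ-toℚ a) (ℚP.toℚᵘ-mono-≤ a≤b))
  = subst₂ ℤ._≤_ (ℤP.*-identityʳ a) (ℤP.*-identityʳ b) a*1≤b*1

sumℚ-cong : ∀ {n} {f g : Fin n → ℚ} → (∀ i → f i ≡ g i) → sumℚ f ≡ sumℚ g
sumℚ-cong {zero}  f≗g = refl
sumℚ-cong {suc n} f≗g = cong₂ ℚ._+_ (f≗g fzero) (sumℚ-cong (f≗g ∘ fsuc))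

sumℚ-zero : ∀ n → sumℚ {n} (λ _ → 0ℚ) ≡ 0ℚ
sumℚ-zero zero    = refl
sumℚ-zero (suc n) = cong (0ℚ ℚ.+_) (sumℚ-zero n)

sumℚ-distrib-+ : ∀ {n} (f g : Fin n → ℚ) → sumℚ (λ i → f i ℚ.+ g i) ≡ sumℚ f ℚ.+ sumℚ g
sumℚ-distrib-+ {zero}  f g = sym (ℚP.+-identityˡ 0ℚ)
sumℚ-distrib-+ {suc n} f g =
  trans (cong (f fzero ℚ.+ g fzero ℚ.+_) (sumℚ-distrib-+ (f ∘ fsuc) (g ∘ fsuc)))
        (ℚ+.interchange (f fzero) (g fzero) _ _)

*-distribˡ-sumℚ : ∀ {n} (a : ℚ) (f : Fin n → ℚ) → a ℚ.* sumℚ f ≡ sumℚ (λ i → a ℚ.* f i)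
*-distribˡ-sumℚ {zero}  a f = ℚP.*-zeroʳ a
*-distribˡ-sumℚ {suc n} a f =
  trans (ℚP.*-distribˡ-+ a (f fzero) _) (cong (a ℚ.* f fzero ℚ.+_) (*-distribˡ-sumℚ a (f ∘ fsuc)))

*-distribʳ-sumℚ : ∀ {n} (a : ℚ) (f : Fin n → ℚ) → sumℚ f ℚ.* a ≡ sumℚ (λ i → f i ℚ.* a)
*-distribʳ-sumℚ a f =
  trans (ℚP.*-comm _ a) (trans (*-distribˡ-sumℚ a f) (sumℚ-cong (λ i → ℚP.*-comm a (f i))))

sumℚ-comm : ∀ {m n} (f : Fin m → Fin n → ℚ) →
            sumℚ (λ i → sumℚ (f i)) ≡ sumℚ (λ j → sumℚ (λ i → f i j))
sumℚ-comm {zero}  {n} f = sym (sumℚ-zero n)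
sumℚ-comm {suc m} {n} f =
  trans (cong (sumℚ (f fzero) ℚ.+_) (sumℚ-comm (f ∘ fsuc)))
        (sym (sumℚ-distrib-+ (f fzero) _))

sumℚ-select : ∀ {n} (i : Fin n) (f : Fin n → ℚ) →
              sumℚ (λ j → if does (i ≟ j) then f j else 0ℚ) ≡ f i
sumℚ-select {suc n} fzero    f = trans (cong (f fzero ℚ.+_) (sumℚ-zero n)) (ℚP.+-identityʳ _)
sumℚ-select {suc n} (fsuc i) f = trans (ℚP.+-identityˡ _) (sumℚ-select i (f ∘ fsuc))

sumℚ-toℚ : ∀ {n} (f : Fin n → ℤ) → sumℚ (λ j → toℚ (f j)) ≡ toℚ (sumℤ f)
sumℚ-toℚ {zero}  f = refl
sumℚ-toℚ {suc n} f =
  trans (cong (toℚ (f fzero) ℚ.+_) (sumℚ-toℚ (f ∘ fsuc))) (sym (toℚ-+ (f fzero) _))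

sumℚ-toℚ-*ʳ : ∀ {n} (f : Fin n → ℤ) (q : ℚ) →
              sumℚ (λ j → toℚ (f j) ℚ.* q) ≡ toℚ (sumℤ f) ℚ.* q
sumℚ-toℚ-*ʳ f q = trans (sym (*-distribʳ-sumℚ q (toℚ ∘ f))) (cong (ℚ._* q) (sumℚ-toℚ f))

·ℚ-toℚ : ∀ {m n} (X : Mat ℤ m n) (x : Vecℤ n) i →
         (X ·ℚ (λ j → toℚ (x j))) i ≡ toℚ ((X ·ℤ x) i)
·ℚ-toℚ X x i = trans (sumℚ-cong (λ j → sym (toℚ-* (X i j) (x j)))) (sumℚ-toℚ (λ j → X i j * x j))

·ℚ-scaled : ∀ {m n} (X : Mat ℤ m n) (x : Vecℤ n) (q : ℚ) i →
            (X ·ℚ (λ j → toℚ (x j) ℚ.* q)) i ≡ toℚ ((X ·ℤ x) i) ℚ.* q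
·ℚ-scaled X x q i = trans (sumℚ-cong regroup) (sumℚ-toℚ-*ʳ (λ j → X i j * x j) q)
  where regroup : ∀ j → toℚ (X i j) ℚ.* (toℚ (x j) ℚ.* q) ≡ toℚ (X i j * x j) ℚ.* q
        regroup j = trans (sym (ℚP.*-assoc (toℚ (X i j)) _ q)) (cong (ℚ._* q) (sym (toℚ-* (X i j) (x j))))

·ℚ-assoc : ∀ {m k n} (X : Mat ℤ m k) (Y : Mat ℤ k n) (v : Vecℚ n) i →
           ((X ⊗ Y) ·ℚ v) i ≡ (X ·ℚ (Y ·ℚ v)) i
·ℚ-assoc X Y v i = begin
  sumℚ (λ j → toℚ (sumℤ (λ l → X i l * Y l j)) ℚ.* v j)
    ≡⟨ sumℚ-cong (λ j → cong (ℚ._* v j) (sym (·ℚ-toℚ X (λ l → Y l j) i))) ⟩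
  sumℚ (λ j → sumℚ (λ l → toℚ (X i l) ℚ.* toℚ (Y l j)) ℚ.* v j)
    ≡⟨ sumℚ-cong (λ j → trans (*-distribʳ-sumℚ (v j) (λ l → toℚ (X i l) ℚ.* toℚ (Y l j)))
                              (sumℚ-cong (λ l → ℚP.*-assoc (toℚ (X i l)) (toℚ (Y l j)) (v j)))) ⟩
  sumℚ (λ j → sumℚ (λ l → toℚ (X i l) ℚ.* (toℚ (Y l j) ℚ.* v j)))
    ≡⟨ sumℚ-comm (λ j l → toℚ (X i l) ℚ.* (toℚ (Y l j) ℚ.* v j)) ⟩
  sumℚ (λ l → sumℚ (λ j → toℚ (X i l) ℚ.* (toℚ (Y l j) ℚ.* v j)))
    ≡⟨ sumℚ-cong (λ l → sym (*-distribˡ-sumℚ (toℚ (X i l)) (λ j → toℚ (Y l j) ℚ.* v j))) ⟩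
  sumℚ (λ l → toℚ (X i l) ℚ.* (Y ·ℚ v) l) ∎
  where open ≡-Reasoning

·ℚ-scaledIdentity : ∀ {n} (a : ℤ) (X : Mat ℤ n n) → (∀ i j → X i j ≡ a * idℤ i j) →
                    (v : Vecℚ n) → ∀ i → (X ·ℚ v) i ≡ toℚ a ℚ.* v i
·ℚ-scaledIdentity a X X≡aI v i = trans (sumℚ-cong entry) (sumℚ-select i (λ j → toℚ a ℚ.* v j))
  where
    scaled-δ : ∀ b x → toℚ (a * (if b then + 1 else + 0)) ℚ.* x ≡ (if b then toℚ a ℚ.* x else 0ℚ)
    scaled-δ true  x = cong (λ z → toℚ z ℚ.* x) (ℤP.*-identityʳ a)
    scaled-δ false x = trans (cong (λ z → toℚ z ℚ.* x) (ℤP.*-zeroʳ a)) (ℚP.*-zeroˡ x)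
    entry : ∀ j → toℚ (X i j) ℚ.* v j ≡ (if does (i ≟ j) then toℚ a ℚ.* v j else 0ℚ)
    entry j rewrite X≡aI i j | δ≡does-≟ i j = scaled-δ (does (i ≟ j)) (v j)

-- Weight vectors and Smith normal forms

-- Weights w with Σ w ≤ p describe the point A w / p of Δ = A S_n, with barycentric
-- coordinates w / p.  It is a lattice point when A w ≡ 0 (mod p), and a vertex of Δ exactly
-- when w is one of the VertexWeights.
ZeroSum : ∀ {m n} → ℕ → Mat ℤ m n → (Fin n → ℕ) → Set
ZeroSum p A w = sumℤ (+ᵛ w) ℤ.≤ + p × (∀ i → + p ∣ (A ·ℤ (+ᵛ w)) i)

VertexWeights : ∀ {n} → ℕ → (Fin n → ℕ) → Set
VertexWeights p w = (∀ i → w i ≡ 0) ⊎ ∃ λ j → ∀ i → w i ≡ (if δ i j then p else 0)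

record ShortZeroSum {m n} (p : ℕ) (A : Mat ℤ m n) (w : Fin n → ℕ) : Set where
  field
    zeroSum : ZeroSum p A w
    index   : Fin n
    0<w     : 0 ℕ.< w index
    w<p     : w index ℕ.< p

shortZeroSum-transfer : ∀ {m m′ n p} {R : Mat ℤ m n} {A : Mat ℤ m′ n} {w} →
                        ShortZeroSum p R w → (∀ i → + p ∣ (A ·ℤ (+ᵛ w)) i) → ShortZeroSum p A w
shortZeroSum-transfer s p∣Aw = record
  { zeroSum = proj₁ zeroSum , p∣Aw ; index = index ; 0<w = 0<w ; w<p = w<p }
  where open ShortZeroSum s

shortZeroSum⇒¬vertexWeights : ∀ {m n p} {A : Mat ℤ m n} {w} → ShortZeroSum p A w → ¬ VertexWeights p w
shortZeroSum⇒¬vertexWeights s (inj₁ w≡0) = ℕP.<⇒≢ (ShortZeroSum.0<w s) (sym (w≡0 _))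
shortZeroSum⇒¬vertexWeights {p = p} {w = w} s (inj₂ (j , w≡pδ)) = excluded (δ index j) (w≡pδ index)
  where
    open ShortZeroSum s
    excluded : ∀ b → w index ≡ (if b then p else 0) → ⊥
    excluded true  eq = ℕP.<⇒≢ w<p eq
    excluded false eq = ℕP.<⇒≢ 0<w (sym eq)

elemAbelian⇒p*⊆image : ∀ {n s p} (A : Mat ℤ n n) → GroupIsElemAbelian p A s →
                       ∀ x → ∃ λ y → ∀ i → (A ·ℤ y) i ≡ + p * x i
elemAbelian⇒p*⊆image {p = p} A (M , kernel , _) x = proj₁ (kernel px) p∣Mpx
  where
    px : Vecℤ _
    px j = + p * x j
    p∣Mpx : ∀ i → + p ℤD.∣ (M ·ℤ px) i
    p∣Mpx i = ℤS.∣⇒∣ᵤ (subst (+ p ∣_) (sym (·ℤ-scale M (+ p) x i)) (ℤS.∣m⇒∣m*n _ ℤS.∣-refl))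

smithForm-·ℤ : ∀ {n} (A U V V′ : Mat ℤ n n) {d : Fin n → ℕ} → (∀ i j → (V ⊗ V′) i j ≡ idℤ i j) →
               (∀ i j → ((U ⊗ A) ⊗ V) i j ≡ (if δ i j then + d i else + 0)) →
               ∀ w i → (U ·ℤ (A ·ℤ w)) i ≡ + d i * (V′ ·ℤ w) i
smithForm-·ℤ A U V V′ {d} VV′≡I UAV≡D w i = begin
  (U ·ℤ (A ·ℤ w)) i                                          ≡⟨ sym (·ℤ-assoc U A w i) ⟩
  ((U ⊗ A) ·ℤ w) i                                           ≡⟨ ·ℤ-congˡ (U ⊗ A) V[V′w]≡w i ⟩
  ((U ⊗ A) ·ℤ (V ·ℤ (V′ ·ℤ w))) i                            ≡⟨ sym (·ℤ-assoc (U ⊗ A) V (V′ ·ℤ w) i) ⟩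
  (((U ⊗ A) ⊗ V) ·ℤ (V′ ·ℤ w)) i                             ≡⟨ ·ℤ-congʳ UAV≡D (V′ ·ℤ w) i ⟩
  sumℤ (λ j → (if δ i j then + d i else + 0) * (V′ ·ℤ w) j)  ≡⟨ ·ℤ-diagonal (+ d i) (V′ ·ℤ w) i ⟩
  + d i * (V′ ·ℤ w) i                                        ∎
  where open ≡-Reasoning
        V[V′w]≡w = λ j → sym (·ℤ-inverse V V′ VV′≡I w j)

elemDivisor∣p : ∀ {n p} (A U U′ : Mat ℤ n n) {d : Fin n → ℕ} →
                (∀ x → ∃ λ y → ∀ i → (A ·ℤ y) i ≡ + p * x i) → (∀ i j → (U ⊗ U′) i j ≡ idℤ i j) →
                (∀ w i → + d i ∣ (U ·ℤ (A ·ℤ w)) i) → ∀ i → d i ℕD.∣ p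
elemDivisor∣p {p = p} A U U′ {d} p*⊆image UU′≡I d∣UA i =
  ℕD.∣-trans (ℤS.∣⇒∣ᵤ (d∣UA y i)) (ℕD.∣-reflexive (cong ℤ.∣_∣ UAy≡p))
  where
    column : Vecℤ _
    column j = U′ j i
    y = proj₁ (p*⊆image column)
    UAy≡p : (U ·ℤ (A ·ℤ y)) i ≡ + p
    UAy≡p = begin
      (U ·ℤ (A ·ℤ y)) i                ≡⟨ ·ℤ-congˡ U (proj₂ (p*⊆image column)) i ⟩
      (U ·ℤ (λ j → + p * column j)) i  ≡⟨ ·ℤ-scale U (+ p) column i ⟩
      + p * (U ·ℤ column) i            ≡⟨ cong (+ p *_) (UU′≡I i i) ⟩
      + p * idℤ i i                    ≡⟨ cong (λ b → + p * (if b then + 1 else + 0)) δᵢᵢ≡true ⟩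
      + p * + 1                        ≡⟨ ℤP.*-identityʳ (+ p) ⟩
      + p                              ∎
      where open ≡-Reasoning
            δᵢᵢ≡true = trans (δ≡does-≟ i i) (dec-true (i ≟ i) refl)

count≤n : ∀ {n} (g : Fin n → Bool) → count g ≤ n
count≤n {zero}  g = z≤n
count≤n {suc n} g with g fzero
... | true  = s≤s (count≤n (g ∘ fsuc))
... | false = ℕP.m≤n⇒m≤1+n (count≤n (g ∘ fsuc))

count-falsePrefix : ∀ {n} (g : Fin n → Bool) m → (∀ i → toℕ i < m → g i ≡ false) → count g ≤ n ℕ.∸ m
count-falsePrefix {zero}  g m       g≡false = z≤n
count-falsePrefix {suc n} g zero    g≡false = count≤n g
count-falsePrefix {suc n} g (suc m) g≡false rewrite g≡false fzero (s≤s z≤n) =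
  count-falsePrefix (g ∘ fsuc) m (λ i i<m → g≡false (fsuc i) (s≤s i<m))

fewNontrivialDivisors : ∀ {n} (d : Fin n → ℕ) → (∀ i j → toℕ i ≤ toℕ j → d i ℕD.∣ d j) →
                        ∀ j → d j ≡ 1 → count (λ i → ⌊ 1 ℕ.<? d i ⌋) ≤ n ℕ.∸ suc (toℕ j)
fewNontrivialDivisors d d∣d j dⱼ≡1 = count-falsePrefix _ (suc (toℕ j)) trivial
  where
    trivial : ∀ i → toℕ i < suc (toℕ j) → ⌊ 1 ℕ.<? d i ⌋ ≡ false
    trivial i (s≤s i≤j) rewrite ℕD.∣1⇒≡1 (subst (d i ℕD.∣_) dⱼ≡1 (d∣d i j i≤j)) = refl

↑-elim : ∀ m {n} {P : Fin (m ℕ.+ n) → Set} → (∀ i → P (i ↑ˡ n)) → (∀ j → P (m ↑ʳ j)) → ∀ k → P k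
↑-elim zero    left right k        = right k
↑-elim (suc m) left right fzero    = left fzero
↑-elim (suc m) left right (fsuc k) = ↑-elim m (left ∘ fsuc) right k

trailingElemDivisors : ∀ {m s p} (d : Fin (m ℕ.+ suc s) → ℕ) → Prime p → (∀ i → d i ℕD.∣ p) →
                       (∀ i → 1 ≤ d i) → (∀ i j → toℕ i ≤ toℕ j → d i ℕD.∣ d j) →
                       s < count (λ i → ⌊ 1 ℕ.<? d i ⌋) → ∀ l → p ℕD.∣ d (m ↑ʳ l)
trailingElemDivisors {m} {s} {p} d p-prime d∣p d≥1 d∣d s<count l =
  subst (ℕD._∣ d (m ↑ʳ l)) dₘ≡p (d∣d (m ↑ʳ fzero) (m ↑ʳ l) m≤m+l)
  where
    m≤m+l : toℕ (m ↑ʳ fzero) ≤ toℕ (m ↑ʳ l)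
    m≤m+l = subst₂ _≤_ (sym (FinP.toℕ-↑ʳ m fzero)) (sym (FinP.toℕ-↑ʳ m l)) (ℕP.+-monoʳ-≤ m z≤n)
    dₘ≢1 : d (m ↑ʳ fzero) ≢ 1
    dₘ≢1 dₘ≡1 = ℕP.<⇒≱ s<count (begin
      count (λ i → ⌊ 1 ℕ.<? d i ⌋)
        ≤⟨ fewNontrivialDivisors d d∣d (m ↑ʳ fzero) dₘ≡1 ⟩
      (m ℕ.+ suc s) ℕ.∸ suc (toℕ (m ↑ʳ fzero))
        ≡⟨ cong (λ t → (m ℕ.+ suc s) ℕ.∸ suc t) (FinP.toℕ-↑ʳ m fzero) ⟩
      (m ℕ.+ suc s) ℕ.∸ suc (m ℕ.+ 0)
        ≡⟨ cong₂ (λ a b → a ℕ.∸ suc b) (ℕP.+-suc m s) (ℕP.+-identityʳ m) ⟩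
      suc (m ℕ.+ s) ℕ.∸ suc m
        ≡⟨ ℕP.m+n∸m≡n m s ⟩
      s ∎)
      where open ℕP.≤-Reasoning
    dₘ≡p : d (m ↑ʳ fzero) ≡ p
    dₘ≡p with prime⇒irreducible p-prime (d∣p (m ↑ʳ fzero))
    ... | inj₁ dₘ≡1 = ⊥-elim (dₘ≢1 dₘ≡1)
    ... | inj₂ dₘ≡p = dₘ≡p

-- Lattice points with denominator p

module _ (p : ℕ) (p⁻¹ : ℚ) .{{_ : ℚ.Positive p⁻¹}} (p*p⁻¹≡1 : toℚ (+ p) ℚ.* p⁻¹ ≡ 1ℚ) where

  private
    P = toℚ (+ p)
    instance
      p⁻¹-nonNegative : ℚ.NonNegative p⁻¹
      p⁻¹-nonNegative = ℚP.pos⇒nonNeg p⁻¹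

  *p⁻¹*p : ∀ x → x ℚ.* p⁻¹ ℚ.* P ≡ x
  *p⁻¹*p x = begin
    x ℚ.* p⁻¹ ℚ.* P    ≡⟨ ℚP.*-assoc x p⁻¹ P ⟩
    x ℚ.* (p⁻¹ ℚ.* P)  ≡⟨ cong (x ℚ.*_) (trans (ℚP.*-comm p⁻¹ P) p*p⁻¹≡1) ⟩
    x ℚ.* 1ℚ           ≡⟨ ℚP.*-identityʳ x ⟩
    x                  ∎
    where open ≡-Reasoning

  *p⁻¹-injective : ∀ {a b} → toℚ a ℚ.* p⁻¹ ≡ toℚ b ℚ.* p⁻¹ → a ≡ b
  *p⁻¹-injective {a} {b} eq =
    toℚ-injective (trans (sym (*p⁻¹*p (toℚ a))) (trans (cong (ℚ._* P) eq) (*p⁻¹*p (toℚ b))))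

  p*⇒*p⁻¹ : ∀ {x y} → P ℚ.* x ≡ y → x ≡ y ℚ.* p⁻¹
  p*⇒*p⁻¹ {x} {y} eq = begin
    x                  ≡⟨ sym (*p⁻¹*p x) ⟩
    x ℚ.* p⁻¹ ℚ.* P    ≡⟨ ℚP.*-comm (x ℚ.* p⁻¹) P ⟩
    P ℚ.* (x ℚ.* p⁻¹)  ≡⟨ sym (ℚP.*-assoc P x p⁻¹) ⟩
    P ℚ.* x ℚ.* p⁻¹    ≡⟨ cong (ℚ._* p⁻¹) eq ⟩
    y ℚ.* p⁻¹          ∎
    where open ≡-Reasoning

  empty⇒vertexWeights : ∀ {n} (A : Mat ℤ n n) → Empty A → ∀ {w} → ZeroSum p A w → VertexWeights p w
  empty⇒vertexWeights A empty {w} (Σw≤p , p∣Aw) = conclude (empty β β≥0 Σβ≤1 (y , Aβ≡y))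
    where
      β : Vecℚ _
      β j = toℚ (+ w j) ℚ.* p⁻¹
      β≥0 : ∀ i → 0ℚ ℚ.≤ β i
      β≥0 i = subst (ℚ._≤ β i) (ℚP.*-zeroˡ p⁻¹)
                    (ℚP.*-monoʳ-≤-nonNeg p⁻¹ (toℚ-mono-≤ (ℤ.+≤+ (z≤n {w i}))))
      Σβ≤1 : sumℚ β ℚ.≤ 1ℚ
      Σβ≤1 = subst₂ ℚ._≤_ (sym (sumℚ-toℚ-*ʳ (+ᵛ w) p⁻¹)) p*p⁻¹≡1
                    (ℚP.*-monoʳ-≤-nonNeg p⁻¹ (toℚ-mono-≤ Σw≤p))
      y : Vecℤ _
      y i = ℤS._∣_.quotient (p∣Aw i)
      Aβ≡y : ∀ i → (A ·ℚ β) i ≡ toℚ (y i)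
      Aβ≡y i = begin
        (A ·ℚ β) i                     ≡⟨ ·ℚ-scaled A (+ᵛ w) p⁻¹ i ⟩
        toℚ ((A ·ℤ (+ᵛ w)) i) ℚ.* p⁻¹  ≡⟨ cong (λ z → toℚ z ℚ.* p⁻¹) (ℤS._∣_.equality (p∣Aw i)) ⟩
        toℚ (y i * + p) ℚ.* p⁻¹        ≡⟨ cong (ℚ._* p⁻¹) (toℚ-* (y i) (+ p)) ⟩
        toℚ (y i) ℚ.* P ℚ.* p⁻¹        ≡⟨ ℚP.*-assoc (toℚ (y i)) P p⁻¹ ⟩
        toℚ (y i) ℚ.* (P ℚ.* p⁻¹)      ≡⟨ cong (toℚ (y i) ℚ.*_) p*p⁻¹≡1 ⟩
        toℚ (y i) ℚ.* 1ℚ               ≡⟨ ℚP.*-identityʳ (toℚ (y i)) ⟩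
        toℚ (y i)                      ∎
        where open ≡-Reasoning
      vertexCoordinate : ∀ {x} b → toℚ (+ x) ℚ.* p⁻¹ ≡ (if b then 1ℚ else 0ℚ) → x ≡ (if b then p else 0)
      vertexCoordinate true  eq = ℤP.+-injective (*p⁻¹-injective (trans eq (sym p*p⁻¹≡1)))
      vertexCoordinate false eq = ℤP.+-injective (*p⁻¹-injective (trans eq (sym (ℚP.*-zeroˡ p⁻¹))))
      conclude : (∀ i → β i ≡ 0ℚ) ⊎ (∃ λ j → ∀ i → β i ≡ idℚ i j) → VertexWeights p w
      conclude (inj₁ β≡0)        = inj₁ (λ i → vertexCoordinate {w i} false (β≡0 i))
      conclude (inj₂ (j , β≡eⱼ)) = inj₂ (j , λ i → vertexCoordinate {w i} (δ i j) (β≡eⱼ i))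

  empty⇒noShortZeroSum : ∀ {n} (A : Mat ℤ n n) → Empty A → ∀ {w} → ¬ ShortZeroSum p A w
  empty⇒noShortZeroSum A empty s =
    shortZeroSum⇒¬vertexWeights s (empty⇒vertexWeights A empty (ShortZeroSum.zeroSum s))

  vertexWeights⇒empty : ∀ {n} (A B : Mat ℤ n n) →
                        (∀ i j → (A ⊗ B) i j ≡ + p * idℤ i j) → (∀ i j → (B ⊗ A) i j ≡ + p * idℤ i j) →
                        (∀ w → ZeroSum p A w → VertexWeights p w) → Empty A
  vertexWeights⇒empty A B AB≡pI BA≡pI onlyVertices β β≥0 Σβ≤1 (x , Aβ≡x) =
    conclude (onlyVertices w (Σw≤p , p∣Aw))
    where
      pβ≡Bx : ∀ i → P ℚ.* β i ≡ toℚ ((B ·ℤ x) i)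
      pβ≡Bx i = begin
        P ℚ.* β i            ≡⟨ sym (·ℚ-scaledIdentity (+ p) (B ⊗ A) BA≡pI β i) ⟩
        ((B ⊗ A) ·ℚ β) i     ≡⟨ ·ℚ-assoc B A β i ⟩
        (B ·ℚ (A ·ℚ β)) i    ≡⟨ sumℚ-cong (λ l → cong (toℚ (B i l) ℚ.*_) (Aβ≡x l)) ⟩
        (B ·ℚ (toℚ ∘ x)) i   ≡⟨ ·ℚ-toℚ B x i ⟩
        toℚ ((B ·ℤ x) i)     ∎
        where open ≡-Reasoning
      Bx≥0 : ∀ i → + 0 ℤ.≤ (B ·ℤ x) i
      Bx≥0 i = toℚ-cancel-≤ (ℚP.*-cancelʳ-≤-pos p⁻¹
                 (subst₂ ℚ._≤_ (sym (ℚP.*-zeroˡ p⁻¹)) (p*⇒*p⁻¹ (pβ≡Bx i)) (β≥0 i)))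
      w : Fin _ → ℕ
      w i = ℤ.∣ (B ·ℤ x) i ∣
      w≡Bx : ∀ i → + w i ≡ (B ·ℤ x) i
      w≡Bx i = ℤP.0≤i⇒+∣i∣≡i (Bx≥0 i)
      β≡w/p : ∀ i → β i ≡ toℚ (+ w i) ℚ.* p⁻¹
      β≡w/p i = trans (p*⇒*p⁻¹ (pβ≡Bx i)) (cong (λ z → toℚ z ℚ.* p⁻¹) (sym (w≡Bx i)))
      Σw≤p : sumℤ (+ᵛ w) ℤ.≤ + p
      Σw≤p = toℚ-cancel-≤ (ℚP.*-cancelʳ-≤-pos p⁻¹
               (subst₂ ℚ._≤_ (trans (sumℚ-cong β≡w/p) (sumℚ-toℚ-*ʳ (+ᵛ w) p⁻¹)) (sym p*p⁻¹≡1) Σβ≤1))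
      p∣Aw : ∀ i → + p ∣ (A ·ℤ (+ᵛ w)) i
      p∣Aw i = subst (+ p ∣_) (sym (trans (·ℤ-congˡ A w≡Bx i) (·ℤ-scaledInverse (+ p) A B AB≡pI x i)))
                     (ℤS.∣m⇒∣m*n (x i) ℤS.∣-refl)
      vertexCoordinate : ∀ {k} b → k ≡ (if b then p else 0) → toℚ (+ k) ℚ.* p⁻¹ ≡ (if b then 1ℚ else 0ℚ)
      vertexCoordinate true  refl = p*p⁻¹≡1
      vertexCoordinate false refl = ℚP.*-zeroˡ p⁻¹
      conclude : VertexWeights p w → (∀ i → β i ≡ 0ℚ) ⊎ ∃ λ j → ∀ i → β i ≡ idℚ i j
      conclude (inj₁ w≡0)         = inj₁ (λ i → trans (β≡w/p i) (vertexCoordinate {w i} false (w≡0 i)))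
      conclude (inj₂ (j , w≡peⱼ)) = inj₂ (j , λ i → trans (β≡w/p i) (vertexCoordinate {w i} (δ i j) (w≡peⱼ i)))

  scaledInverse⇒invertible : ∀ {n} (A B : Mat ℤ n n) →
                             (∀ i j → (A ⊗ B) i j ≡ + p * idℤ i j) → (∀ i j → (B ⊗ A) i j ≡ + p * idℤ i j) →
                             Invertible A
  scaledInverse⇒invertible A B AB≡pI BA≡pI = B/p , A[B/p]≡I , [B/p]A≡I
    where
      B/p : Mat ℚ _ _
      B/p i j = toℚ (B i j) ℚ.* p⁻¹
      pI/p : ∀ i j → toℚ (+ p * idℤ i j) ℚ.* p⁻¹ ≡ idℚ i j
      pI/p i j with δ i j
      ... | true  = trans (cong (λ z → toℚ z ℚ.* p⁻¹) (ℤP.*-identityʳ (+ p))) p*p⁻¹≡1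
      ... | false = trans (cong (λ z → toℚ z ℚ.* p⁻¹) (ℤP.*-zeroʳ (+ p))) (ℚP.*-zeroˡ p⁻¹)
      A[B/p]≡I : ∀ i j → sumℚ (λ l → toℚ (A i l) ℚ.* B/p l j) ≡ idℚ i j
      A[B/p]≡I i j = trans (·ℚ-scaled A (λ l → B l j) p⁻¹ i)
                           (trans (cong (λ z → toℚ z ℚ.* p⁻¹) (AB≡pI i j)) (pI/p i j))
      regroup : ∀ i j l → B/p i l ℚ.* toℚ (A l j) ≡ toℚ (B i l * A l j) ℚ.* p⁻¹
      regroup i j l = begin
        toℚ (B i l) ℚ.* p⁻¹ ℚ.* toℚ (A l j)    ≡⟨ ℚP.*-assoc (toℚ (B i l)) p⁻¹ _ ⟩
        toℚ (B i l) ℚ.* (p⁻¹ ℚ.* toℚ (A l j))  ≡⟨ cong (toℚ (B i l) ℚ.*_) (ℚP.*-comm p⁻¹ _) ⟩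
        toℚ (B i l) ℚ.* (toℚ (A l j) ℚ.* p⁻¹)  ≡⟨ sym (ℚP.*-assoc (toℚ (B i l)) _ p⁻¹) ⟩
        toℚ (B i l) ℚ.* toℚ (A l j) ℚ.* p⁻¹    ≡⟨ cong (ℚ._* p⁻¹) (sym (toℚ-* (B i l) (A l j))) ⟩
        toℚ (B i l * A l j) ℚ.* p⁻¹            ∎
        where open ≡-Reasoning
      [B/p]A≡I : ∀ i j → sumℚ (λ l → B/p i l ℚ.* toℚ (A l j)) ≡ idℚ i j
      [B/p]A≡I i j = trans (sumℚ-cong (regroup i j)) (trans (sumℚ-toℚ-*ʳ (λ l → B i l * A l j) p⁻¹)
                           (trans (cong (λ z → toℚ z ℚ.* p⁻¹) (BA≡pI i j)) (pI/p i j)))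

  -- Below its first m rows U A is divisible by p (those elementary divisors are all p),
  -- so a short zero sum of the first m rows R is one of U A, hence of A.
  upperBound : ∀ {m s} → Prime p → ((R : Mat ℤ m (m ℕ.+ suc s)) → ∃ (ShortZeroSum p R)) →
               (A : Mat ℤ (m ℕ.+ suc s) (m ℕ.+ suc s)) (k : ℕ) →
               Invertible A → Empty A → PPower p A → Cr A k → k ≤ s
  upperBound {m} {s} p-prime shortZeroSums A k _ empty (_ , elemAbelian)
             (d , (U , V , (U′ , UU′≡I , U′U≡I) , (V′ , VV′≡I , _) , UAV≡D , d≥1 , d∣d) , refl) =
    ℕP.≮⇒≥ λ s<k → empty⇒noShortZeroSum A empty (shortZeroSum-transfer short (p∣Ac s<k))
    where
      d∣UA : ∀ w i → + d i ∣ (U ·ℤ (A ·ℤ w)) i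
      d∣UA w i = subst (+ d i ∣_) (sym (smithForm-·ℤ A U V V′ VV′≡I UAV≡D w i)) (ℤS.∣m⇒∣m*n _ ℤS.∣-refl)
      d∣p = elemDivisor∣p A U U′ (elemAbelian⇒p*⊆image A elemAbelian) UU′≡I d∣UA
      R : Mat ℤ m (m ℕ.+ suc s)
      R t = (U ⊗ A) (t ↑ˡ suc s)
      c = proj₁ (shortZeroSums R)
      short = proj₂ (shortZeroSums R)
      p∣UAc : s < k → ∀ i → + p ∣ (U ·ℤ (A ·ℤ (+ᵛ c))) i
      p∣UAc s<k = ↑-elim m
        (λ t → subst (+ p ∣_) (·ℤ-assoc U A (+ᵛ c) (t ↑ˡ suc s)) (proj₂ (ShortZeroSum.zeroSum short) t))
        (λ l → ℤS.∣-trans (ℤS.∣ᵤ⇒∣ (trailingElemDivisors d p-prime d∣p d≥1 d∣d s<k l))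
                          (d∣UA (+ᵛ c) (m ↑ʳ l)))
      p∣Ac : s < k → ∀ i → + p ∣ (A ·ℤ (+ᵛ c)) i
      p∣Ac s<k i = subst (+ p ∣_) (·ℤ-inverse U′ U U′U≡I (A ·ℤ (+ᵛ c)) i)
                         (∣-sumℤ _ (λ j → ℤS.∣n⇒∣m*n (U′ i j) (p∣UAc s<k j)))

-- Short zero sums from coincidences among the columns

withOrigin : ∀ {m n} → Mat ℤ m n → Mat ℤ m (suc n)
withOrigin R i fzero    = + 0
withOrigin R i (fsuc j) = R i j

multiplicity : ∀ {n} → List (Fin n) → Fin n → ℕ
multiplicity js j = length (filter (_≟ j) js)

columnSum : ∀ {m n} → Mat ℤ m n → List (Fin n) → Vecℤ m
columnSum R []       i = + 0
columnSum R (j ∷ js) i = R i j + columnSum R js i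

multiplicity-∷ : ∀ {n} (x : Fin n) js j →
                 + multiplicity (x ∷ js) j ≡ (if does (x ≟ j) then + 1 else + 0) + + multiplicity js j
multiplicity-∷ x js j with does (x ≟ j)
... | true  = refl
... | false = sym (ℤP.+-identityˡ _)

·ℤ-multiplicity : ∀ {m n} (R : Mat ℤ m n) js i → (R ·ℤ (+ᵛ multiplicity js)) i ≡ columnSum R js i
·ℤ-multiplicity {n = n} R [] i = trans (sumℤ-cong (λ j → ℤP.*-zeroʳ (R i j))) (sumℤ-zero n)
·ℤ-multiplicity R (x ∷ js) i = begin
  sumℤ (λ j → R i j * + multiplicity (x ∷ js) j)
    ≡⟨ sumℤ-cong (λ j → trans (cong (R i j *_) (multiplicity-∷ x js j)) (ℤP.*-distribˡ-+ (R i j) _ _)) ⟩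
  sumℤ (λ j → R i j * [x≟ j ] + R i j * + multiplicity js j)
    ≡⟨ sumℤ-distrib-+ (λ j → R i j * [x≟ j ]) (λ j → R i j * + multiplicity js j) ⟩
  sumℤ (λ j → R i j * [x≟ j ]) + (R ·ℤ (+ᵛ multiplicity js)) i
    ≡⟨ cong₂ _+_ (trans (sumℤ-cong (λ j → select (does (x ≟ j)) (R i j))) (sumℤ-select x (R i)))
                 (·ℤ-multiplicity R js i) ⟩
  R i x + columnSum R js i ∎
  where
    open ≡-Reasoning
    [x≟_] : _ → ℤ
    [x≟ j ] = if does (x ≟ j) then + 1 else + 0
    select : ∀ b r → r * (if b then + 1 else + 0) ≡ (if b then r else + 0)
    select true  r = ℤP.*-identityʳ r
    select false r = ℤP.*-zeroʳ r

sumℤ-multiplicity : ∀ {n} (js : List (Fin n)) → sumℤ (+ᵛ multiplicity js) ≡ + length js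
sumℤ-multiplicity js = begin
  sumℤ (+ᵛ multiplicity js)       ≡⟨ sumℤ-cong (λ j → sym (ℤP.*-identityˡ (+ multiplicity js j))) ⟩
  (ones ·ℤ (+ᵛ multiplicity js)) fzero  ≡⟨ ·ℤ-multiplicity ones js fzero ⟩
  columnSum ones js fzero         ≡⟨ columnSum-ones js ⟩
  + length js                     ∎
  where
    open ≡-Reasoning
    ones : Mat ℤ 1 _
    ones _ _ = + 1
    columnSum-ones : ∀ js → columnSum ones js fzero ≡ + length js
    columnSum-ones []       = refl
    columnSum-ones (j ∷ js) = trans (cong (_+_ (+ 1)) (columnSum-ones js)) (sym (ℤP.pos-+ 1 (length js)))

-- Column 0 of withOrigin R is the vertex 0 of Δ.  The barycentre of a multiset of p vertices,
-- not all equal, whose sum is divisible by p is a lattice point of Δ that is not a vertex;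
-- the multiplicities of the columns of R form a short zero sum.
multisetShortZeroSum : ∀ {m n p} (R : Mat ℤ m n) (js : List (Fin (suc n))) → length js ≡ p →
                       (∀ i → + p ∣ columnSum (withOrigin R) js i) →
                       ∀ {a b} → a ∈ js → b ∈ js → a ≢ b → ∃ (ShortZeroSum p R)
multisetShortZeroSum {m} {n} {p} R js |js|≡p p∣Σ a∈js b∈js a≢b = c ∘ fsuc , short a∈js b∈js a≢b
  where
    c = multiplicity js
    Σc≤p : sumℤ (+ᵛ (c ∘ fsuc)) ℤ.≤ + p
    Σc≤p = subst (sumℤ (+ᵛ (c ∘ fsuc)) ℤ.≤_) (trans (sumℤ-multiplicity js) (cong +_ |js|≡p))
                 (ℤP.i≤j+i _ (+ c fzero))
    p∣Rc : ∀ i → + p ∣ (R ·ℤ (+ᵛ (c ∘ fsuc))) i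
    p∣Rc i = subst (+ p ∣_) (trans (sym (·ℤ-multiplicity (withOrigin R) js i)) (ℤP.+-identityˡ _)) (p∣Σ i)
    0<c : ∀ {j} → j ∈ js → 0 < c j
    0<c {j} j∈js = ListP.filter-some (_≟ j) (Any.map sym j∈js)
    c<p : ∀ {j k} → k ∈ js → k ≢ j → c j < p
    c<p {j} k∈js k≢j =
      subst (c j <_) |js|≡p (ListP.filter-notAll (_≟ j) js (Any.map (λ { refl → k≢j }) k∈js))
    short : ∀ {a b} → a ∈ js → b ∈ js → a ≢ b → ShortZeroSum p R (c ∘ fsuc)
    short {fsuc a} a∈js b∈js a≢b =
      record { zeroSum = Σc≤p , p∣Rc ; index = a ; 0<w = 0<c a∈js ; w<p = c<p b∈js (a≢b ∘ sym) }
    short {fzero} {fsuc b} a∈js b∈js a≢b =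
      record { zeroSum = Σc≤p , p∣Rc ; index = b ; 0<w = 0<c b∈js ; w<p = c<p a∈js a≢b }
    short {fzero} {fzero} a∈js b∈js a≢b = ⊥-elim (a≢b refl)

columnSum-replicate : ∀ {m n} (R : Mat ℤ m n) k r i → columnSum R (replicate r k) i ≡ + r * R i k
columnSum-replicate R k zero    i = sym (ℤP.*-zeroˡ (R i k))
columnSum-replicate R k (suc r) i = begin
  R i k + columnSum R (replicate r k) i  ≡⟨ cong (_+_ (R i k)) (columnSum-replicate R k r i) ⟩
  R i k + + r * R i k                    ≡⟨ sym (ℤP.suc-* (+ r) (R i k)) ⟩
  ℤ.suc (+ r) * R i k                    ∎
  where open ≡-Reasoning

congruentColumns⇒shortZeroSum : ∀ {m n p} → 1 < p → (R : Mat ℤ m n) (j k : Fin (suc n)) → j ≢ k →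
                                (∀ i → + p ∣ withOrigin R i j - withOrigin R i k) → ∃ (ShortZeroSum p R)
congruentColumns⇒shortZeroSum {p = 1} (s≤s ()) R j k j≢k p∣Rj-Rk
congruentColumns⇒shortZeroSum {p = suc (suc p′)} _ R j k j≢k p∣Rj-Rk =
  multisetShortZeroSum R (j ∷ replicate (suc p′) k) (cong (suc ∘ suc) (ListP.length-replicate p′))
                       p∣Σ (here refl) (there (here refl)) j≢k
  where
    R′ = withOrigin R
    p∣Σ : ∀ i → + suc (suc p′) ∣ columnSum R′ (j ∷ replicate (suc p′) k) i
    p∣Σ i = subst (+ suc (suc p′) ∣_) (sym (begin
      R′ i j + columnSum R′ (replicate (suc p′) k) i
        ≡⟨ cong (_+_ (R′ i j)) (columnSum-replicate R′ k (suc p′) i) ⟩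
      R′ i j + + suc p′ * R′ i k
        ≡⟨ regroup (R′ i j) (R′ i k) (+ suc p′) ⟩
      (R′ i j - R′ i k) + (+ 1 + + suc p′) * R′ i k ∎))
      (ℤS.∣m∣n⇒∣m+n (p∣Rj-Rk i) (ℤS.∣m⇒∣m*n (R′ i k) ℤS.∣-refl))
      where open ≡-Reasoning
            regroup : ∀ x y q → x + q * y ≡ (x - y) + (+ 1 + q) * y
            regroup = solve-∀

collinearColumns⇒shortZeroSum : ∀ {m n} (R : Mat ℤ m n) (j k l : Fin (suc n)) → j ≢ k →
                                (∀ i → + 3 ∣ withOrigin R i j + withOrigin R i k + withOrigin R i l) →
                                ∃ (ShortZeroSum 3 R)
collinearColumns⇒shortZeroSum R j k l j≢k 3∣Σ =
  multisetShortZeroSum R (j ∷ k ∷ l ∷ []) refl (λ i → subst (+ 3 ∣_) (reassociate i) (3∣Σ i))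
                       (here refl) (there (here refl)) j≢k
  where
    R′ = withOrigin R
    reassociate : ∀ i → R′ i j + R′ i k + R′ i l ≡ columnSum R′ (j ∷ k ∷ l ∷ []) i
    reassociate i = trans (ℤP.+-assoc (R′ i j) (R′ i k) (R′ i l))
                          (cong (λ z → R′ i j + (R′ i k + z)) (sym (ℤP.+-identityʳ (R′ i l))))

p∣x-x%p : ∀ p .{{_ : ℕ.NonZero p}} x → + p ∣ x - + (x %ℕ p)
p∣x-x%p p x = ℤS.divides (x /ℕ p) (begin
  x - + (x %ℕ p)                          ≡⟨ cong (_- + (x %ℕ p)) (a≡a%ℕn+[a/ℕn]*n x p) ⟩
  + (x %ℕ p) + x /ℕ p * + p - + (x %ℕ p)  ≡⟨ cancel (+ (x %ℕ p)) (x /ℕ p * + p) ⟩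
  x /ℕ p * + p                            ∎)
  where open ≡-Reasoning
        cancel : ∀ r q → r + q - r ≡ q
        cancel = solve-∀

sameResidue⇒p∣- : ∀ p .{{_ : ℕ.NonZero p}} x y → x %ℕ p ≡ y %ℕ p → + p ∣ x - y
sameResidue⇒p∣- p x y eq = subst (+ p ∣_) (regroup x y (+ (x %ℕ p)))
  (ℤS.∣m∣n⇒∣m-n (p∣x-x%p p x) (subst (λ r → + p ∣ y - + r) (sym eq) (p∣x-x%p p y)))
  where regroup : ∀ x y r → (x - r) - (y - r) ≡ x - y
        regroup = solve-∀

residueSum⇒p∣ : ∀ p .{{_ : ℕ.NonZero p}} x y z → p ℕD.∣ x %ℕ p ℕ.+ y %ℕ p ℕ.+ z %ℕ p → + p ∣ x + y + z
residueSum⇒p∣ p x y z p∣Σr = subst (+ p ∣_) (regroup x y z (+ (x %ℕ p)) (+ (y %ℕ p)) (+ (z %ℕ p)))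
  (ℤS.∣m∣n⇒∣m+n (ℤS.∣m∣n⇒∣m+n (ℤS.∣m∣n⇒∣m+n (p∣x-x%p p x) (p∣x-x%p p y)) (p∣x-x%p p z))
                (subst (+ p ∣_) Σr≡ (ℤS.∣ᵤ⇒∣ p∣Σr)))
  where
    regroup : ∀ x y z a b c → (x - a) + (y - b) + (z - c) + (a + b + c) ≡ x + y + z
    regroup = solve-∀
    Σr≡ : + (x %ℕ p ℕ.+ y %ℕ p ℕ.+ z %ℕ p) ≡ + (x %ℕ p) + + (y %ℕ p) + + (z %ℕ p)
    Σr≡ = trans (ℤP.pos-+ _ (z %ℕ p)) (cong (_+ + (z %ℕ p)) (ℤP.pos-+ (x %ℕ p) (y %ℕ p)))

residues : ∀ {m n} p .{{_ : ℕ.NonZero p}} → Mat ℤ m n → Fin n → Fin m → Fin p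
residues p R j i = Fin.fromℕ< (n%ℕd<d (R i j) p)

pigeonholeShortZeroSum : ∀ {m n p} → 1 < p → p ℕ.^ m < suc n → (R : Mat ℤ m n) → ∃ (ShortZeroSum p R)
pigeonholeShortZeroSum {p = 1} (s≤s ()) _ R
pigeonholeShortZeroSum {m} {n} {p@(suc (suc _))} 1<p pᵐ<n+1 R
  with j , k , j<k , same ← FinP.pigeonhole pᵐ<n+1 (Fin.funToFin ∘ residues p (withOrigin R))
  = congruentColumns⇒shortZeroSum 1<p R j k (FinP.<⇒≢ j<k)
      (λ i → sameResidue⇒p∣- p (R′ i j) (R′ i k) (sameResidue i))
  where
    R′ = withOrigin R
    sameResidue : ∀ i → R′ i j %ℕ p ≡ R′ i k %ℕ p
    sameResidue i = begin
      R′ i j %ℕ p                                          ≡⟨ FinP.toℕ-fromℕ< _ ⟨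
      toℕ (residues p R′ j i)                              ≡⟨ cong toℕ (FinP.finToFun-funToFin (residues p R′ j) i) ⟨
      toℕ (Fin.finToFun (Fin.funToFin (residues p R′ j)) i)  ≡⟨ cong (λ c → toℕ (Fin.finToFun c i)) same ⟩
      toℕ (Fin.finToFun (Fin.funToFin (residues p R′ k)) i)  ≡⟨ cong toℕ (FinP.finToFun-funToFin (residues p R′ k) i) ⟩
      toℕ (residues p R′ k i)                              ≡⟨ FinP.toℕ-fromℕ< _ ⟩
      R′ i k %ℕ p                                          ∎
      where open ≡-Reasoning

-- Caps in 𝔽₃³

-- A point of 𝔽₃³ with digits a b c < 3 is coded as the number a + 3 (b + 3 c) < 27, and
-- third u v is the code of the third point on the line through u and v.
code : ℕ → ℕ → ℕ → ℕ
code a b c = a ℕ.+ 3 ℕ.* (b ℕ.+ 3 ℕ.* c)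

negSum₃ : ℕ → ℕ → ℕ
negSum₃ x y = (6 ℕ.∸ (x ℕ.+ y)) % 3

third : ℕ → ℕ → ℕ
third u v = code (negSum₃ (u % 3) (v % 3)) (negSum₃ (u / 3 % 3) (v / 3 % 3)) (negSum₃ (u / 9) (v / 9))

∀digit? : ∀ {P : ℕ → Set} → Decidable P → Dec (∀ {x} → x < 3 → P x)
∀digit? P? = ℕP.allUpTo? P? 3

code-injective : ∀ {a} → a < 3 → ∀ {b} → b < 3 → ∀ {c} → c < 3 →
                 ∀ {a′} → a′ < 3 → ∀ {b′} → b′ < 3 → ∀ {c′} → c′ < 3 →
                 code a b c ≡ code a′ b′ c′ → a ≡ a′ × b ≡ b′ × c ≡ c′
code-injective = from-yes
  (∀digit? λ a → ∀digit? λ b → ∀digit? λ c → ∀digit? λ a′ → ∀digit? λ b′ → ∀digit? λ c′ →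
     (code a b c ℕP.≟ code a′ b′ c′) →-dec ((a ℕP.≟ a′) ×-dec (b ℕP.≟ b′) ×-dec (c ℕP.≟ c′)))

third-code : ∀ {a} → a < 3 → ∀ {b} → b < 3 → ∀ {c} → c < 3 →
             ∀ {a′} → a′ < 3 → ∀ {b′} → b′ < 3 → ∀ {c′} → c′ < 3 →
             third (code a b c) (code a′ b′ c′) ≡ code (negSum₃ a a′) (negSum₃ b b′) (negSum₃ c c′)
third-code = from-yes
  (∀digit? λ a → ∀digit? λ b → ∀digit? λ c → ∀digit? λ a′ → ∀digit? λ b′ → ∀digit? λ c′ →
     third (code a b c) (code a′ b′ c′) ℕP.≟ code (negSum₃ a a′) (negSum₃ b b′) (negSum₃ c c′))

3∣+negSum₃ : ∀ {x} → x < 3 → ∀ {y} → y < 3 → 3 ℕD.∣ x ℕ.+ y ℕ.+ negSum₃ x y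
3∣+negSum₃ = from-yes (∀digit? λ x → ∀digit? λ y → 3 ℕD.∣? x ℕ.+ y ℕ.+ negSum₃ x y)

code<27 : ∀ {a} → a < 3 → ∀ {b} → b < 3 → ∀ {c} → c < 3 → code a b c < 27
code<27 = from-yes (∀digit? λ a → ∀digit? λ b → ∀digit? λ c → suc (code a b c) ℕP.≤? 27)

negSum₃<3 : ∀ x y → negSum₃ x y < 3
negSum₃<3 x y = m%n<n (6 ℕ.∸ (x ℕ.+ y)) 3

third-collinear : ∀ {a a′ a″ b b′ b″ c c′ c″} →
                  a < 3 → b < 3 → c < 3 → a′ < 3 → b′ < 3 → c′ < 3 → a″ < 3 → b″ < 3 → c″ < 3 →
                  third (code a b c) (code a′ b′ c′) ≡ code a″ b″ c″ →
                  3 ℕD.∣ a ℕ.+ a′ ℕ.+ a″ × 3 ℕD.∣ b ℕ.+ b′ ℕ.+ b″ × 3 ℕD.∣ c ℕ.+ c′ ℕ.+ c″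
third-collinear {a} {a′} {a″} {b} {b′} {b″} {c} {c′} {c″} ha hb hc ha′ hb′ hc′ ha″ hb″ hc″ eq =
  digitwise (code-injective (negSum₃<3 a a′) (negSum₃<3 b b′) (negSum₃<3 c c′) ha″ hb″ hc″
                            (trans (sym (third-code ha hb hc ha′ hb′ hc′)) eq))
  where
    digitwise : negSum₃ a a′ ≡ a″ × negSum₃ b b′ ≡ b″ × negSum₃ c c′ ≡ c″ →
                3 ℕD.∣ a ℕ.+ a′ ℕ.+ a″ × 3 ℕD.∣ b ℕ.+ b′ ℕ.+ b″ × 3 ℕD.∣ c ℕ.+ c′ ℕ.+ c″
    digitwise (refl , refl , refl) = 3∣+negSum₃ ha ha′ , 3∣+negSum₃ hb hb′ , 3∣+negSum₃ hc hc′

InRange : ℕ → ℕ → ℕ → Set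
InRange i f x = i ≤ x × x < i ℕ.+ f

shiftRange : ∀ {i f xs} → All (InRange i (suc f)) xs → All (i <_) xs → All (InRange (suc i) f) xs
shiftRange {i} {f} inRange i<xs = All.zipWith shift (inRange , i<xs)
  where shift : ∀ {x} → InRange i (suc f) x × i < x → InRange (suc i) f x
        shift {x} ((_ , x<i+1+f) , i<x) = i<x , subst (x <_) (ℕP.+-suc i f) x<i+1+f

increasing⇒length≤ : ∀ f i xs → AllPairs _<_ xs → All (InRange i f) xs → length xs ≤ f
increasing⇒length≤ zero    i []       _ _ = z≤n
increasing⇒length≤ zero    i (x ∷ xs) _ ((i≤x , x<i+0) ∷ _) =
  ⊥-elim (ℕP.<⇒≱ (subst (x <_) (ℕP.+-identityʳ i) x<i+0) i≤x)
increasing⇒length≤ (suc f) i []       _ _ = z≤n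
increasing⇒length≤ (suc f) i (x ∷ xs) xs↑@(x<xs ∷ xs′↑) xs∈@((i≤x , _) ∷ xs′∈) with x ℕP.≟ i
... | yes refl = s≤s (increasing⇒length≤ f (suc x) xs xs′↑ (shiftRange xs′∈ x<xs))
... | no x≢i   = ℕP.m≤n⇒m≤1+n (increasing⇒length≤ f (suc i) (x ∷ xs) xs↑
                   (shiftRange xs∈ (i<x ∷ All.map (ℕP.<-trans i<x) x<xs)))
  where i<x = ℕP.≤∧≢⇒< i≤x (x≢i ∘ sym)

module CapSearch (third : ℕ → ℕ → ℕ) (k : ℕ) where

  -- extends f i ch fb: can the cap ch be completed to k points using points of [i, i + f)?
  -- Points are added in increasing order; fb lists the third points of lines through ch.
  extends : ℕ → ℕ → List ℕ → List ℕ → Bool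
  extends zero    i ch fb = k ≤ᵇ length ch
  extends (suc f) i ch fb =
    if length ch ℕ.+ suc f <ᵇ k then false
    else ((not (any (_≡ᵇ i) fb) ∧ extends f (suc i) (i ∷ ch) (map (third i) ch ++ fb)) ∨ extends f (suc i) ch fb)

  CapFree : (ℕ → Set) → Set
  CapFree P = ∀ {a b} → a ≢ b → P a → P b → ¬ P (third a b)

  module _ {P : ℕ → Set} (capFree : CapFree P) where

    ∉-any : ∀ {x} zs → P x → All (¬_ ∘ P) zs → any (_≡ᵇ x) zs ≡ false
    ∉-any     []       Px []           = refl
    ∉-any {x} (z ∷ zs) Px (¬Pz ∷ ¬Pzs) with z ≡ᵇ x in z≡ᵇx
    ... | true  = ⊥-elim (¬Pz (subst P (sym (ℕP.≡ᵇ⇒≡ z x (subst T (sym z≡ᵇx) _))) Px))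
    ... | false = ∉-any zs Px ¬Pzs

    extends-sound : ∀ f i ch fb xs → extends f i ch fb ≡ false →
                    All P ch → All (_< i) ch → All (¬_ ∘ P) fb →
                    All P xs → AllPairs _<_ xs → All (InRange i f) xs → length ch ℕ.+ length xs < k
    extends-sound zero i ch fb xs ext _ _ _ _ xs↑ xs∈
      rewrite ℕP.n≤0⇒n≡0 (increasing⇒length≤ 0 i xs xs↑ xs∈) | ℕP.+-identityʳ (length ch) =
      ℕP.≰⇒> (λ k≤ch → subst T ext (ℕP.≤⇒≤ᵇ k≤ch))
    extends-sound (suc f) i ch fb xs ext Pch ch<i ¬Pfb Pxs xs↑ xs∈ with length ch ℕ.+ suc f <ᵇ k in prune
    ... | true  = ℕP.≤-<-trans (ℕP.+-monoʳ-≤ (length ch) (increasing⇒length≤ (suc f) i xs xs↑ xs∈))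
                               (ℕP.<ᵇ⇒< _ _ (subst T (sym prune) _))
    ... | false with xs | xs↑ | xs∈ | Pxs
    ...   | []      | []           | []               | []         =
      extends-sound f (suc i) ch fb [] (BoolP.∨-conicalʳ _ _ ext) Pch (All.map ℕP.m<n⇒m<1+n ch<i) ¬Pfb [] [] []
    ...   | x ∷ xs′ | x<xs′ ∷ xs′↑ | (i≤x , x<) ∷ xs′∈ | Px ∷ Pxs′ with x ℕP.≟ i
    ...     | yes refl =
      subst (_< k) (sym (ℕP.+-suc (length ch) (length xs′)))
        (extends-sound f (suc x) (x ∷ ch) (map (third x) ch ++ fb) xs′ added (Px ∷ Pch)
           (ℕP.n<1+n x ∷ All.map ℕP.m<n⇒m<1+n ch<i) (AllP.++⁺ (AllP.map⁺ newlyForbidden) ¬Pfb)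
           Pxs′ xs′↑ (shiftRange xs′∈ x<xs′))
      where
        added : extends f (suc x) (x ∷ ch) (map (third x) ch ++ fb) ≡ false
        added = BoolP.∨-conicalˡ _ _
          (subst (λ b → not b ∧ extends f (suc x) (x ∷ ch) (map (third x) ch ++ fb) ∨ extends f (suc x) ch fb
                          ≡ false)
                 (∉-any fb Px ¬Pfb) ext)
        newlyForbidden : All (¬_ ∘ P ∘ third x) ch
        newlyForbidden = All.zipWith (λ (Pb , b<x) → capFree (ℕP.>⇒≢ b<x) Px Pb) (Pch , ch<i)
    ...     | no x≢i =
      extends-sound f (suc i) ch fb (x ∷ xs′) (BoolP.∨-conicalʳ _ _ ext) Pch (All.map ℕP.m<n⇒m<1+n ch<i) ¬Pfb
        (Px ∷ Pxs′) (x<xs′ ∷ xs′↑) (shiftRange ((i≤x , x<) ∷ xs′∈) (i<x ∷ All.map (ℕP.<-trans i<x) x<xs′))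
      where i<x = ℕP.≤∧≢⇒< i≤x (x≢i ∘ sym)

open CapSearch third 10

headOfIncreasing≡0 : ∀ {x xs} → All (x <_) xs → 0 ∈ x ∷ xs → x ≡ 0
headOfIncreasing≡0 x<xs (here 0≡x)   = sym 0≡x
headOfIncreasing≡0 x<xs (there 0∈xs) = ⊥-elim (ℕP.n≮0 (All.lookup x<xs 0∈xs))

cap0-notExtendable : extends 26 1 (0 ∷ []) [] ≡ false
cap0-notExtendable = refl

noCapOf10 : ∀ {P} → CapFree P → ∀ xs → AllPairs _<_ xs → 0 ∈ xs → All (λ x → P x × x < 27) xs →
            length xs < 10
noCapOf10 {P} capFree (x ∷ xs) (x<xs ∷ xs↑) 0∈ ((Px , _) ∷ Pxs) =
  extends-sound capFree 26 1 (0 ∷ []) [] xs cap0-notExtendable (subst P x≡0 Px ∷ []) (s≤s z≤n ∷ []) []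
    (All.map proj₁ Pxs) xs↑ (All.zipWith (λ (x<y , (_ , y<27)) → subst (_< _) x≡0 x<y , y<27) (x<xs , Pxs))
  where x≡0 = headOfIncreasing≡0 x<xs 0∈

module _ (R : Mat ℤ 3 9) where

  private
    R′ = withOrigin R
    digit : Fin 3 → Fin 10 → ℕ
    digit t j = R′ t j %ℕ 3
    digit<3 : ∀ t j → digit t j < 3
    digit<3 t j = n%ℕd<d (R′ t j) 3

  columnCode : Fin 10 → ℕ
  columnCode j = code (digit 0F j) (digit 1F j) (digit 2F j)

  SamePoint : Fin 10 → Fin 10 → Set
  SamePoint j k = ∀ t → digit t j ≡ digit t k

  Collinear : Fin 10 → Fin 10 → Fin 10 → Set
  Collinear j k l = ∀ t → 3 ℕD.∣ digit t j ℕ.+ digit t k ℕ.+ digit t l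

  sameCode⇒samePoint : ∀ j k → columnCode j ≡ columnCode k → SamePoint j k
  sameCode⇒samePoint j k eq =
    byRows (code-injective (digit<3 0F j) (digit<3 1F j) (digit<3 2F j) (digit<3 0F k) (digit<3 1F k) (digit<3 2F k) eq)
    where
      byRows : digit 0F j ≡ digit 0F k × digit 1F j ≡ digit 1F k × digit 2F j ≡ digit 2F k → SamePoint j k
      byRows (e₀ , e₁ , e₂) 0F = e₀
      byRows (e₀ , e₁ , e₂) 1F = e₁
      byRows (e₀ , e₁ , e₂) 2F = e₂

  thirdCode⇒collinear : ∀ j k l → third (columnCode j) (columnCode k) ≡ columnCode l → Collinear j k l
  thirdCode⇒collinear j k l eq =
    byRows (third-collinear (digit<3 0F j) (digit<3 1F j) (digit<3 2F j) (digit<3 0F k) (digit<3 1F k) (digit<3 2F k)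
                            (digit<3 0F l) (digit<3 1F l) (digit<3 2F l) eq)
    where
      byRows : 3 ℕD.∣ digit 0F j ℕ.+ digit 0F k ℕ.+ digit 0F l × 3 ℕD.∣ digit 1F j ℕ.+ digit 1F k ℕ.+ digit 1F l ×
               3 ℕD.∣ digit 2F j ℕ.+ digit 2F k ℕ.+ digit 2F l → Collinear j k l
      byRows (d₀ , d₁ , d₂) 0F = d₀
      byRows (d₀ , d₁ , d₂) 1F = d₁
      byRows (d₀ , d₁ , d₂) 2F = d₂

  columnsFormNoCap : (∀ {j k} → j ≢ k → ¬ SamePoint j k) → (∀ {j k l} → j ≢ k → ¬ Collinear j k l) → ⊥
  columnsFormNoCap distinct noLine = ℕP.<-irrefl length≡10 (noCapOf10 capFree sorted increasing 0∈sorted bounded)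
    where
      codes = map columnCode (allFin 10)
      sorted = sort codes
      code⁻ : ∀ {x} → x ∈ codes → ∃ λ j → j ∈ allFin 10 × x ≡ columnCode j
      code⁻ = ∈-map⁻ columnCode {xs = allFin 10}
      capFree : CapFree (_∈ codes)
      capFree a≢b a∈ b∈ c∈ with code⁻ a∈ | code⁻ b∈ | code⁻ c∈
      ... | j , _ , refl | k , _ , refl | l , _ , eq =
        noLine {j} {k} {l} (λ { refl → a≢b refl }) (thirdCode⇒collinear j k l eq)
      columnCode-injective : ∀ {j k} → columnCode j ≡ columnCode k → j ≡ k
      columnCode-injective {j} {k} eq with j ≟ k
      ... | yes j≡k = j≡k
      ... | no j≢k  = ⊥-elim (distinct j≢k (sameCode⇒samePoint j k eq))
      unique : Unique sorted
      unique = PermutationSetoid.Unique-resp-↭ (setoid ℕ) (↭⇒↭ₛ (↭-sym (sort-↭ codes)))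
                 (Unique.map⁺ {f = columnCode} columnCode-injective (Unique.allFin⁺ 10))
      increasing : AllPairs _<_ sorted
      increasing = AllPairs.zipWith (λ (x≤y , x≢y) → ℕP.≤∧≢⇒< x≤y x≢y)
                                    (Linked⇒AllPairs ℕP.≤-trans (sort-↗ codes) , unique)
      0∈sorted : 0 ∈ sorted
      0∈sorted = ∈-resp-↭ (↭-sym (sort-↭ codes)) (∈-map⁺ columnCode (∈-allFin 0F))
      codes<27 : ∀ {x} → x ∈ codes → x < 27
      codes<27 x∈ with j , _ , refl ← code⁻ x∈ = code<27 (digit<3 0F j) (digit<3 1F j) (digit<3 2F j)
      bounded : All (λ x → x ∈ codes × x < 27) sorted
      bounded = All.tabulate λ x∈ → ∈-resp-↭ (sort-↭ codes) x∈ , codes<27 (∈-resp-↭ (sort-↭ codes) x∈)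
      length≡10 : length sorted ≡ 10
      length≡10 = trans (↭-length (sort-↭ codes)) (ListP.length-map columnCode (allFin 10))

  coincidence? : Dec (∃ λ j → ∃ λ k → j ≢ k × SamePoint j k)
  coincidence? = FinP.any? λ j → FinP.any? λ k → ¬? (j ≟ k) ×-dec FinP.all? (λ t → digit t j ℕP.≟ digit t k)

  line? : Dec (∃ λ j → ∃ λ k → ∃ λ l → j ≢ k × Collinear j k l)
  line? = FinP.any? λ j → FinP.any? λ k → FinP.any? λ l →
            ¬? (j ≟ k) ×-dec FinP.all? (λ t → 3 ℕD.∣? digit t j ℕ.+ digit t k ℕ.+ digit t l)

  shortZeroSum₃ : ∃ (ShortZeroSum 3 R)
  shortZeroSum₃ = fromCoincidence coincidence?
    where
      fromLine : ¬ (∃ λ j → ∃ λ k → j ≢ k × SamePoint j k) →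
                 Dec (∃ λ j → ∃ λ k → ∃ λ l → j ≢ k × Collinear j k l) → ∃ (ShortZeroSum 3 R)
      fromLine _ (yes (j , k , l , j≢k , collinear)) =
        collinearColumns⇒shortZeroSum R j k l j≢k (λ t → residueSum⇒p∣ 3 (R′ t j) (R′ t k) (R′ t l) (collinear t))
      fromLine noPair (no noLine) =
        ⊥-elim (columnsFormNoCap (λ {j} {k} j≢k same → noPair (j , k , j≢k , same))
                                 (λ {j} {k} {l} j≢k line → noLine (j , k , l , j≢k , line)))
      fromCoincidence : Dec (∃ λ j → ∃ λ k → j ≢ k × SamePoint j k) → ∃ (ShortZeroSum 3 R)
      fromCoincidence (yes (j , k , j≢k , same)) =
        congruentColumns⇒shortZeroSum (s≤s (s≤s z≤n)) R j k j≢k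
                                      (λ t → sameResidue⇒p∣- 3 (R′ t j) (R′ t k) (same t))
      fromCoincidence (no noPair) = fromLine noPair line?

-- The lower-bound simplices

allWithSum≤? : ∀ {n} {P : Vec ℕ n → Set} → (∀ v → Dec (P v)) → ∀ b → Dec (∀ v → Vec.sum v ≤ b → P v)
allWithSum≤? {zero}  {P} P? b = map′ (λ { P[] [] _ → P[] }) (λ all → all [] z≤n) (P? [])
allWithSum≤? {suc n} {P} P? b =
  map′ split join (ℕP.allUpTo? (λ x → allWithSum≤? (λ v → P? (x ∷ v)) (b ℕ.∸ x)) (suc b))
  where
    split : (∀ {x} → x < suc b → ∀ v → Vec.sum v ≤ b ℕ.∸ x → P (x ∷ v)) → ∀ u → Vec.sum u ≤ b → P u
    split all (x ∷ v) x+v≤b = all (s≤s (ℕP.≤-trans (ℕP.m≤m+n x _) x+v≤b)) v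
                                  (ℕP.m+n≤o⇒m≤o∸n (Vec.sum v) (subst (_≤ b) (ℕP.+-comm x _) x+v≤b))
    join : (∀ u → Vec.sum u ≤ b → P u) → ∀ {x} → x < suc b → ∀ v → Vec.sum v ≤ b ℕ.∸ x → P (x ∷ v)
    join all (s≤s x≤b) v v≤b∸x =
      all (_ ∷ v) (subst (_≤ b) (ℕP.+-comm (Vec.sum v) _) (ℕP.m≤o∸n⇒m+n≤o (Vec.sum v) x≤b v≤b∸x))

vertexWeights? : ∀ {n} p (w : Fin n → ℕ) → Dec (VertexWeights p w)
vertexWeights? p w =
  FinP.all? (λ i → w i ℕP.≟ 0) ⊎-dec FinP.any? (λ j → FinP.all? (λ i → w i ℕP.≟ (if δ i j then p else 0)))

sumℤ-tabulate : ∀ {n} (w : Fin n → ℕ) → sumℤ (+ᵛ w) ≡ + Vec.sum (tabulate w)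
sumℤ-tabulate {zero}  w = refl
sumℤ-tabulate {suc n} w =
  trans (cong (_+_ (+ w fzero)) (sumℤ-tabulate (w ∘ fsuc))) (sym (ℤP.pos-+ (w fzero) _))

vertexWeights-cong : ∀ {n p} {w w′ : Fin n → ℕ} → (∀ i → w i ≡ w′ i) → VertexWeights p w → VertexWeights p w′
vertexWeights-cong w≗w′ (inj₁ w≡0)        = inj₁ (λ i → trans (sym (w≗w′ i)) (w≡0 i))
vertexWeights-cong w≗w′ (inj₂ (j , w≡pδ)) = inj₂ (j , λ i → trans (sym (w≗w′ i)) (w≡pδ i))

vertexWeights-fromVectors : ∀ {n p} (A : Mat ℤ n n) →
  (∀ v → Vec.sum v ≤ p → (∀ i → + p ∣ (A ·ℤ (+ᵛ lookup v)) i) → VertexWeights p (lookup v)) →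
  ∀ w → ZeroSum p A w → VertexWeights p w
vertexWeights-fromVectors {p = p} A vertexWeightsᵛ w (Σw≤p , p∣Aw) =
  vertexWeights-cong (VecP.lookup∘tabulate w)
    (vertexWeightsᵛ (tabulate w) (ℤP.drop‿+≤+ (subst (ℤ._≤ + p) (sumℤ-tabulate w) Σw≤p))
       (λ i → subst (+ p ∣_) (·ℤ-congˡ A (λ j → cong +_ (sym (VecP.lookup∘tabulate w j))) i) (p∣Aw i)))

trailingRows⇒ppower : ∀ {k s p} .{{_ : ℕ.NonZero p}} (A B : Mat ℤ (k ℕ.+ s) (k ℕ.+ s)) →
                      (∀ i j → (A ⊗ B) i j ≡ + p * idℤ i j) →
                      (∀ l j → + p ∣ A (k ↑ʳ l) j) → (∀ i j → + p ∣ B i (j ↑ˡ s)) → PPower p A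
trailingRows⇒ppower {k} {s} {p} A B AB≡pI p∣A p∣B = s , M , (λ x → inImage x , image⇒p∣Mx x) , surjective
  where
    M : Mat ℤ s (k ℕ.+ s)
    M l = idℤ (k ↑ʳ l)
    M·x : ∀ x l → (M ·ℤ x) l ≡ x (k ↑ʳ l)
    M·x x l = ·ℤ-identityˡ x (k ↑ʳ l)
    inImage : ∀ x → (∀ l → + p ℤD.∣ (M ·ℤ x) l) → ∃ λ y → ∀ i → (A ·ℤ y) i ≡ x i
    inImage x p∣Mx = y , λ i → ℤP.*-cancelˡ-≡ (+ p) _ _ (begin
      + p * (A ·ℤ y) i            ≡⟨ sym (·ℤ-scale A (+ p) y i) ⟩
      (A ·ℤ (λ j → + p * y j)) i  ≡⟨ ·ℤ-congˡ A py≡Bx i ⟩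
      (A ·ℤ (B ·ℤ x)) i           ≡⟨ ·ℤ-scaledInverse (+ p) A B AB≡pI x i ⟩
      + p * x i                   ∎)
      where
        open ≡-Reasoning
        p∣x : ∀ l → + p ∣ x (k ↑ʳ l)
        p∣x l = subst (+ p ∣_) (M·x x l) (ℤS.∣ᵤ⇒∣ (p∣Mx l))
        p∣Bx : ∀ i → + p ∣ (B ·ℤ x) i
        p∣Bx i = ∣-sumℤ _ (↑-elim k (λ j → ℤS.∣m⇒∣m*n (x (j ↑ˡ s)) (p∣B i j))
                                    (λ l → ℤS.∣n⇒∣m*n (B i (k ↑ʳ l)) (p∣x l)))
        y : Vecℤ (k ℕ.+ s)
        y i = ℤS._∣_.quotient (p∣Bx i)
        py≡Bx : ∀ i → + p * y i ≡ (B ·ℤ x) i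
        py≡Bx i = trans (ℤP.*-comm (+ p) (y i)) (sym (ℤS._∣_.equality (p∣Bx i)))
    image⇒p∣Mx : ∀ x → (∃ λ y → ∀ i → (A ·ℤ y) i ≡ x i) → ∀ l → + p ℤD.∣ (M ·ℤ x) l
    image⇒p∣Mx x (y , Ay≡x) l = ℤS.∣⇒∣ᵤ (subst (+ p ∣_) (trans (Ay≡x (k ↑ʳ l)) (sym (M·x x l)))
                                                (∣-sumℤ _ (λ j → ℤS.∣m⇒∣m*n (y j) (p∣A l j))))
    surjective : ∀ t → ∃ λ x → ∀ l → + p ℤD.∣ (M ·ℤ x) l - t l
    surjective t = x , λ l → ℤS.∣⇒∣ᵤ (subst (+ p ∣_) (sym (Mx-t≡0 l)) (ℤS.divides (+ 0) refl))
      where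
        x : Vecℤ (k ℕ.+ s)
        x j = [ (λ _ → + 0) , t ]′ (splitAt k j)
        Mx-t≡0 : ∀ l → (M ·ℤ x) l - t l ≡ + 0
        Mx-t≡0 l = trans (cong (_- t l) (trans (M·x x l) (cong [ (λ _ → + 0) , t ]′ (FinP.splitAt-↑ʳ k s l))))
                         (ℤP.+-inverseʳ (t l))

rightDiagonalisation⇒cr : ∀ {n} (A V V′ : Mat ℤ n n) (d : Fin n → ℕ) →
                          (∀ i j → (V ⊗ V′) i j ≡ idℤ i j) → (∀ i j → (V′ ⊗ V) i j ≡ idℤ i j) →
                          (∀ i j → (A ⊗ V) i j ≡ (if δ i j then + d i else + 0)) →
                          (∀ i → 1 ≤ d i) → (∀ i j → toℕ i ≤ toℕ j → d i ℕD.∣ d j) →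
                          Cr A (count (λ i → ⌊ 1 ℕ.<? d i ⌋))
rightDiagonalisation⇒cr A V V′ d VV′≡I V′V≡I AV≡D d≥1 d∣d =
  d , (idℤ , V , (idℤ , ⊗-identityˡ idℤ , ⊗-identityˡ idℤ) , (V′ , VV′≡I , V′V≡I) , IAV≡D , d≥1 , d∣d)
    , refl
  where IAV≡D : ∀ i j → ((idℤ ⊗ A) ⊗ V) i j ≡ (if δ i j then + d i else + 0)
        IAV≡D i j = trans (sumℤ-cong (λ l → cong (_* V l j) (⊗-identityˡ A i l))) (AV≡D i j)

blockUpper : ∀ {k s} → ℤ → Mat ℤ k s → ℤ → Mat ℤ (k ℕ.+ s) (k ℕ.+ s)
blockUpper {k} a N b i j with splitAt k i | splitAt k j
... | inj₁ i′ | inj₁ j′ = a * idℤ i′ j′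
... | inj₁ i′ | inj₂ j′ = N i′ j′
... | inj₂ _  | inj₁ _  = + 0
... | inj₂ i′ | inj₂ j′ = b * idℤ i′ j′

-- A = [[I₄, N], [0, p·I₅]], with p·A⁻¹ = B = [[p·I₄, -N], [0, I₅]] and A V = diag d for
-- V = [[I₄, -N], [0, I₅]].  Every fact in Checks is finite and is decided by computation.
module BlockSimplex (p : ℕ) (N : Mat ℤ 4 5) where

  A B V V′ : Mat ℤ 9 9
  A  = blockUpper (+ 1) N (+ p)
  B  = blockUpper (+ p) (λ i j → ℤ.- N i j) (+ 1)
  V  = blockUpper (+ 1) (λ i j → ℤ.- N i j) (+ 1)
  V′ = blockUpper (+ 1) N (+ 1)

  d : Fin 9 → ℕ
  d i = [ (λ _ → 1) , (λ _ → p) ]′ (splitAt 4 i)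

  Checks : Set
  Checks = (∀ i j → (A ⊗ B) i j ≡ + p * idℤ i j) × (∀ i j → (B ⊗ A) i j ≡ + p * idℤ i j)
         × (∀ v → Vec.sum v ≤ p → (∀ i → + p ∣ (A ·ℤ (+ᵛ lookup v)) i) → VertexWeights p (lookup v))
         × (∀ (l : Fin 5) j → + p ∣ A (4 ↑ʳ l) j) × (∀ i (j : Fin 4) → + p ∣ B i (j ↑ˡ 5))
         × (∀ i j → (V ⊗ V′) i j ≡ idℤ i j) × (∀ i j → (V′ ⊗ V) i j ≡ idℤ i j)
         × (∀ i j → (A ⊗ V) i j ≡ (if δ i j then + d i else + 0))
         × (∀ i → 1 ≤ d i) × (∀ i j → toℕ i ≤ toℕ j → d i ℕD.∣ d j)

  checks? : Dec Checks
  checks? =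
    (∀ij? λ i j → (A ⊗ B) i j ℤ.≟ + p * idℤ i j) ×-dec (∀ij? λ i j → (B ⊗ A) i j ℤ.≟ + p * idℤ i j)
    ×-dec allWithSum≤? (λ v → FinP.all? (λ i → + p ℤS.∣? (A ·ℤ (+ᵛ lookup v)) i)
                                →-dec vertexWeights? p (lookup v)) p
    ×-dec (∀ij? λ l j → + p ℤS.∣? A (4 ↑ʳ l) j) ×-dec (∀ij? λ i j → + p ℤS.∣? B i (j ↑ˡ 5))
    ×-dec (∀ij? λ i j → (V ⊗ V′) i j ℤ.≟ idℤ i j) ×-dec (∀ij? λ i j → (V′ ⊗ V) i j ℤ.≟ idℤ i j)
    ×-dec (∀ij? λ i j → (A ⊗ V) i j ℤ.≟ (if δ i j then + d i else + 0))
    ×-dec FinP.all? (λ i → 1 ℕP.≤? d i) ×-dec (∀ij? λ i j → (toℕ i ℕP.≤? toℕ j) →-dec (d i ℕD.∣? d j))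
    where ∀ij? : ∀ {m n} {P : Fin m → Fin n → Set} → (∀ i j → Dec (P i j)) → Dec (∀ i j → P i j)
          ∀ij? P? = FinP.all? (λ i → FinP.all? (P? i))

  blockSimplex : .{{_ : ℕ.NonZero p}} (p⁻¹ : ℚ) .{{_ : ℚ.Positive p⁻¹}} →
                 toℚ (+ p) ℚ.* p⁻¹ ≡ 1ℚ → Checks →
                 Σ (Mat ℤ 9 9) λ A → Invertible A × Empty A × PPower p A × Cr A (count (λ i → ⌊ 1 ℕ.<? d i ⌋))
  blockSimplex p⁻¹ p*p⁻¹≡1
               (AB≡pI , BA≡pI , vertexWeightsᵛ , p∣A , p∣B , VV′≡I , V′V≡I , AV≡D , d≥1 , d∣d) =
    A , scaledInverse⇒invertible p p⁻¹ p*p⁻¹≡1 A B AB≡pI BA≡pI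
      , vertexWeights⇒empty p p⁻¹ p*p⁻¹≡1 A B AB≡pI BA≡pI (vertexWeights-fromVectors A vertexWeightsᵛ)
      , trailingRows⇒ppower {k = 4} {s = 5} A B AB≡pI p∣A p∣B
      , rightDiagonalisation⇒cr A V V′ d VV′≡I V′V≡I AV≡D d≥1 d∣d

N₂ N₃ : Mat ℤ 4 5
N₂ i j = lookup (lookup rows i) j
  where rows : Vec (Vec ℤ 5) 4
        rows = (+ 1 ∷ + 1 ∷ + 1 ∷ + 0 ∷ + 0 ∷ []) ∷ (+ 1 ∷ + 0 ∷ + 0 ∷ + 1 ∷ + 1 ∷ []) ∷
               (+ 0 ∷ + 1 ∷ + 0 ∷ + 1 ∷ + 0 ∷ []) ∷ (+ 0 ∷ + 0 ∷ + 1 ∷ + 0 ∷ + 1 ∷ []) ∷ []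
N₃ i j = lookup (lookup rows i) j
  where rows : Vec (Vec ℤ 5) 4
        rows = (+ 0 ∷ + 0 ∷ + 0 ∷ + 0 ∷ + 1 ∷ []) ∷ (+ 0 ∷ + 1 ∷ + 1 ∷ + 1 ∷ + 0 ∷ []) ∷
               (+ 1 ∷ + 0 ∷ + 1 ∷ + 1 ∷ + 0 ∷ []) ∷ (+ 1 ∷ + 1 ∷ + 0 ∷ + 1 ∷ + 1 ∷ []) ∷ []

shortZeroSum₂ : (R : Mat ℤ 3 9) → ∃ (ShortZeroSum 2 R)
shortZeroSum₂ = pigeonholeShortZeroSum (s≤s (s≤s z≤n)) (from-yes (8 ℕP.<? 10))

proposition5p5 : CrP≡ 2 9 5 × CrP≡ 3 9 5
proposition5p5 =
  ( BlockSimplex.blockSimplex 2 N₂ (+ 1 ℚ./ 2) refl (from-yes (BlockSimplex.checks? 2 N₂))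
  , upperBound 2 (+ 1 ℚ./ 2) refl prime[2] shortZeroSum₂ )
  , ( BlockSimplex.blockSimplex 3 N₃ (+ 1 ℚ./ 3) refl (from-yes (BlockSimplex.checks? 3 N₃))
  , upperBound 3 (+ 1 ℚ./ 3) refl (from-yes (prime? 3)) shortZeroSum₃ )
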